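{- Let $M$ and $N$ be matroids with $T=E(M)\cap E(N)$ nonempty. If $T$ is independent in both $M$ and $N$, then the bonding $B_T(M,N)$ is the free amalgam of $M$ and $N$.
   Context: Bonding: let $T=\{t_1,\ldots,t_k\}$, and fix sets $S=\{s_1,\ldots,s_k\}$ and $Q=\{q_1,\ldots,q_k\}$ disjoint from each other and from $E(M)\cup E(N)$. Form $N'$ from $N$ by relabeling each $t_i$ as $s_i$. Form $H$ from $M\oplus N'$ by, for each $i\in[k]$, adding $q_i$ freely to the flat $\mathrm{cl}_{M\oplus N'}(\{t_i,s_i\})$, i.e., taking the principal extension $L+_Xq$ with $X=\mathrm{cl}(\{t_i,s_i\})$, whose rank function is $r'(Y)=r_L(Y)$ and $r'(Y\cup q)=r_L(Y)$ if $X\subseteq \mathrm{cl}_L(Y)$, $r_L(Y)+1$ otherwise (the order of these extensions does not matter). Then $B_T(M,N)=H/Q\backslash S$, a matroid on $E(M)\cup E(N)$. An amalgam of $M$ and $N$ is a matroid $K$ on $E(M)\cup E(N)$ with $K|E(M)=M$ and $K|E(N)=N$; the free amalgam is an amalgam $K$ such that every set independent in some amalgam is independent in $K$. -}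

module Defs where

open import Data.Bool using (Bool; true; false; _∧_; _∨_; not; if_then_else_; T)
open import Data.Nat using (ℕ; _+_; _∸_; _≤_; _≡ᵇ_)
open import Data.List using (List; []; _∷_; _++_; map; length; foldl; filterᵇ; deduplicateᵇ)
open import Data.Bool.ListAction using (any; all)
open import Data.Product using (_×_; ∃; _,_)
open import Relation.Nullary using (¬_)
open import Relation.Binary.PropositionalEquality using (_≡_; _≢_)

-- Elements of all matroids are natural numbers; a (finite or not) set of
-- elements is a decidable predicate ℕ → Bool.
Sub : Set
Sub = ℕ → Bool

infix 5 _∈ᵇ_
infix 4 _⊆_ _≐_
infixl 6 _∪ˢ_ _∩ˢ_ _∖ˢ_

_∈ᵇ_ : ℕ → List ℕ → Bool
x ∈ᵇ l = any (x ≡ᵇ_) l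

⟦_⟧ : List ℕ → Sub
⟦ l ⟧ x = x ∈ᵇ l

｛_｝ : ℕ → Sub
｛ a ｝ x = x ≡ᵇ a

_∪ˢ_ : Sub → Sub → Sub
(X ∪ˢ Y) x = X x ∨ Y x

_∩ˢ_ : Sub → Sub → Sub
(X ∩ˢ Y) x = X x ∧ Y x

_∖ˢ_ : Sub → Sub → Sub
(X ∖ˢ Y) x = X x ∧ not (Y x)

_⊆_ : Sub → Sub → Set
X ⊆ Y = ∀ x → T (X x) → T (Y x)

_≐_ : Sub → Sub → Set
X ≐ Y = ∀ x → X x ≡ Y x

card : List ℕ → Sub → ℕ
card E X = length (deduplicateᵇ _≡ᵇ_ (filterᵇ X E))

-- A matroid is given by a finite ground set and a rank function
-- (only its values on subsets of the ground set are meaningful).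
record RawMatroid : Set where
  constructor mkRaw
  field
    ground : List ℕ
    rank   : Sub → ℕ
open RawMatroid public

-- Rank axioms (R1)-(R3) (Oxley), plus: the rank depends only on the set.
record IsMatroid (M : RawMatroid) : Set where
  field
    r-ext    : ∀ X Y → X ⊆ ⟦ ground M ⟧ → X ≐ Y → rank M X ≡ rank M Y
    r-bound  : ∀ X → X ⊆ ⟦ ground M ⟧ → rank M X ≤ card (ground M) X
    r-mono   : ∀ X Y → X ⊆ Y → Y ⊆ ⟦ ground M ⟧ → rank M X ≤ rank M Y
    r-submod : ∀ X Y → X ⊆ ⟦ ground M ⟧ → Y ⊆ ⟦ ground M ⟧ →
               rank M (X ∪ˢ Y) + rank M (X ∩ˢ Y) ≤ rank M X + rank M Y

Indep : RawMatroid → Sub → Set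
Indep M X = X ⊆ ⟦ ground M ⟧ × rank M X ≡ card (ground M) X

sameSet : List ℕ → List ℕ → Set
sameSet A B = ∀ x → x ∈ᵇ A ≡ x ∈ᵇ B

IsAmalgam : RawMatroid → RawMatroid → RawMatroid → Set
IsAmalgam K M N =
  IsMatroid K ×
  sameSet (ground K) (ground M ++ ground N) ×
  (∀ X → X ⊆ ⟦ ground M ⟧ → rank K X ≡ rank M X) ×
  (∀ X → X ⊆ ⟦ ground N ⟧ → rank K X ≡ rank N X)

IsFreeAmalgam : RawMatroid → RawMatroid → RawMatroid → Set
IsFreeAmalgam K M N =
  IsAmalgam K M N ×
  (∀ K' → IsAmalgam K' M N → ∀ X → Indep K' X → Indep K X)

directSum : RawMatroid → RawMatroid → RawMatroid
directSum A B = mkRaw (ground A ++ ground B)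
  (λ Y → rank A (Y ∩ˢ ⟦ ground A ⟧) + rank B (Y ∩ˢ ⟦ ground B ⟧))

-- relabel the elements of N along φ (assumed injective on E(N))
relabel : RawMatroid → (ℕ → ℕ) → RawMatroid
relabel N φ = mkRaw (map φ (ground N))
  (λ Y → rank N (λ x → (x ∈ᵇ ground N) ∧ Y (φ x)))

closure : RawMatroid → Sub → Sub
closure L Y e = (e ∈ᵇ ground L) ∧ (rank L (Y ∪ˢ ｛ e ｝) ≡ᵇ rank L Y)

subsetᵇ : List ℕ → Sub → Sub → Bool
subsetᵇ E X Y = all (λ e → not (X e) ∨ Y e) E

-- principal extension L +_X q (q a new element)
principalExt : RawMatroid → Sub → ℕ → RawMatroid
principalExt L X q = mkRaw (q ∷ ground L)
  (λ Y → rank L (Y ∖ˢ ｛ q ｝) +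
         (if Y q ∧ not (subsetᵇ (ground L) X (closure L (Y ∖ˢ ｛ q ｝)))
          then 1 else 0))

contract : RawMatroid → Sub → RawMatroid
contract L C = mkRaw (filterᵇ (λ x → not (C x)) (ground L))
  (λ Y → rank L (Y ∪ˢ C) ∸ rank L C)

delete : RawMatroid → Sub → RawMatroid
delete L D = mkRaw (filterᵇ (λ x → not (D x)) (ground L)) (λ Y → rank L Y)

Tset : RawMatroid → RawMatroid → Sub
Tset M N x = (x ∈ᵇ ground M) ∧ (x ∈ᵇ ground N)

Tlist : RawMatroid → RawMatroid → List ℕ
Tlist M N = deduplicateᵇ _≡ᵇ_ (filterᵇ (λ x → x ∈ᵇ ground N) (ground M))

-- s_i = σ t_i and q_i = κ t_i.
-- B_T(M,N) = H / Q \ S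
bonding : RawMatroid → RawMatroid → (ℕ → ℕ) → (ℕ → ℕ) → RawMatroid
bonding M N σ κ = delete (contract H Q) S
  where
  Tl = Tlist M N
  φ : ℕ → ℕ
  φ x = if x ∈ᵇ Tl then σ x else x
  N' = relabel N φ
  D = directSum M N'
  H = foldl (λ L t → principalExt L (closure D (｛ t ｝ ∪ˢ ｛ σ t ｝)) (κ t)) D Tl
  Q : Sub
  Q x = any (λ t → κ t ≡ᵇ x) Tl
  S : Sub
  S x = any (λ t → σ t ≡ᵇ x) Tl

record FreshLabels (M N : RawMatroid) (σ κ : ℕ → ℕ) : Set where
  field
    σ-inj   : ∀ t t' → T (Tset M N t) → T (Tset M N t') → σ t ≡ σ t' → t ≡ t'
    κ-inj   : ∀ t t' → T (Tset M N t) → T (Tset M N t') → κ t ≡ κ t' → t ≡ t'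
    σκ-disj : ∀ t t' → T (Tset M N t) → T (Tset M N t') → σ t ≢ κ t'
    σ-fresh : ∀ t → T (Tset M N t) → ¬ T (σ t ∈ᵇ ground M) × ¬ T (σ t ∈ᵇ ground N)
    κ-fresh : ∀ t → T (Tset M N t) → ¬ T (κ t ∈ᵇ ground M) × ¬ T (κ t ∈ᵇ ground N)

{-# OPTIONS --safe #-}
-- Let k = |T|. Adding each q_t freely to cl{t, s_t} makes r_H(X ∪ Q) the minimum over T' ⊆ T
-- of r_{M⊕N'}(X ∪ ⋃_{t ∈ T'} cl{t, s_t}) + |T ∖ T'|. Each closure is spanned by its pair
-- {t, s_t}, so the term for T' equals r_M((X ∩ E(M)) ∪ T') + r_N((X ∩ E(N) ∖ T) ∪ T') + |T ∖ T'|.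
-- As T is independent in M and in N, r_M(T') = r_N(T') = |T'|; hence r_H(Q) = k, so
-- r_B(X) = r_H(X ∪ Q) − k, and the choices T' = ∅ and T' = X ∩ T show that B restricts to M
-- on E(M) and to N on E(N). For an amalgam K' and a K'-independent X, submodularity of r_{K'}
-- on the two sets above, whose intersection contains T', bounds every term below by |X| + k,
-- so X is independent in B.
module Submission where

open import Defs
open import Data.Bool using (Bool; true; false; _∧_; _∨_; not; if_then_else_; T)
open import Data.Bool.Properties using (∨-identityʳ; ∨-assoc; ∧-distribˡ-∨; ∧-distribʳ-∨; ∨-distribʳ-∧; ∧-zeroʳ; ∨-zeroʳ; T-∧; T-∨)
open import Data.Bool.ListAction using (any)
open import Data.Nat using (ℕ; suc; _+_; _∸_; _≤_; _≡ᵇ_; z≤n; s≤s; _⊓_)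
open import Data.Nat.Properties
open import Data.Nat.Tactic.RingSolver using (solve-∀)
open import Algebra.Properties.CommutativeSemigroup +-commutativeSemigroup using () renaming (interchange to +-interchange)
open import Algebra.Properties.CommutativeSemigroup ⊓-commutativeSemigroup using () renaming (interchange to ⊓-interchange)
open import Data.List using (List; []; _∷_; _++_; map; length; foldl; filter; filterᵇ; deduplicateᵇ)
open import Data.List.Properties using (length-map; length-filter)
open import Data.Product using (_×_; ∃; _,_; proj₁; proj₂; Σ)
open import Data.Sum using (_⊎_; inj₁; inj₂; [_,_]′)
open import Data.Unit using (⊤; tt)
open import Data.Empty using (⊥; ⊥-elim)
open import Function using (_∘_; case_of_; Equivalence)
open import Level using (0ℓ)
open import Relation.Nullary using (¬_; yes; no; ¬?)
open import Relation.Nullary.Decidable using (T?)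
open import Relation.Unary using (Pred; Decidable)
open import Relation.Binary.PropositionalEquality
  using (_≡_; _≢_; refl; sym; trans; cong; cong₂; subst; subst₂; module ≡-Reasoning)

T-∧⁺ : ∀ {a b} → T a → T b → T (a ∧ b)
T-∧⁺ p q = Equivalence.from T-∧ (p , q)

T-∧⁻ˡ : ∀ {a b} → T (a ∧ b) → T a
T-∧⁻ˡ {a} {b} p = proj₁ (Equivalence.to (T-∧ {a} {b}) p)

T-∧⁻ʳ : ∀ {a b} → T (a ∧ b) → T b
T-∧⁻ʳ {a} {b} p = proj₂ (Equivalence.to (T-∧ {a} {b}) p)

T-∨⁺ˡ : ∀ {a b} → T a → T (a ∨ b)
T-∨⁺ˡ p = Equivalence.from T-∨ (inj₁ p)

T-∨⁺ʳ : ∀ {a b} → T b → T (a ∨ b)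
T-∨⁺ʳ {a} p = Equivalence.from (T-∨ {a}) (inj₂ p)

T-∨⁻ : ∀ {a b} → T (a ∨ b) → T a ⊎ T b
T-∨⁻ {a} {b} = Equivalence.to (T-∨ {a} {b})

T-not⁺ : ∀ {a} → ¬ T a → T (not a)
T-not⁺ {true} f = f tt
T-not⁺ {false} _ = tt

T-not⁻ : ∀ {a} → T (not a) → ¬ T a
T-not⁻ {true} () _

T-dec : ∀ b → T b ⊎ ¬ T b
T-dec true = inj₁ tt
T-dec false = inj₂ (λ ())

T⇒≡true : ∀ {b} → T b → b ≡ true
T⇒≡true {true} _ = refl

¬T⇒≡false : ∀ {b} → ¬ T b → b ≡ false
¬T⇒≡false {true} f = ⊥-elim (f tt)
¬T⇒≡false {false} _ = refl

T-injective : ∀ {a b} → (T a → T b) → (T b → T a) → a ≡ b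
T-injective {true} {true} _ _ = refl
T-injective {true} {false} f _ = ⊥-elim (f tt)
T-injective {false} {true} _ g = ⊥-elim (g tt)
T-injective {false} {false} _ _ = refl

T-≡ᵇ-refl : ∀ n → T (n ≡ᵇ n)
T-≡ᵇ-refl n = ≡⇒≡ᵇ n n refl

T-≡ᵇ⁻ : ∀ {m n} → T (m ≡ᵇ n) → m ≡ n
T-≡ᵇ⁻ {m} {n} = ≡ᵇ⇒≡ m n

T-≡ᵇ⁺ : ∀ {m n} → m ≡ n → T (m ≡ᵇ n)
T-≡ᵇ⁺ {m} {n} = ≡⇒≡ᵇ m n

≡ᵇ-comm : ∀ m n → (m ≡ᵇ n) ≡ (n ≡ᵇ m)
≡ᵇ-comm m n = T-injective (λ p → T-≡ᵇ⁺ (sym (T-≡ᵇ⁻ {m} p))) (λ p → T-≡ᵇ⁺ (sym (T-≡ᵇ⁻ {n} p)))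

∅ˢ : Sub
∅ˢ _ = false

⊆-refl : ∀ X → X ⊆ X
⊆-refl X x p = p

⊆-trans : ∀ X Y Z → X ⊆ Y → Y ⊆ Z → X ⊆ Z
⊆-trans X Y Z f g x p = g x (f x p)

⊆-antisym : ∀ {X Y} → X ⊆ Y → Y ⊆ X → X ≐ Y
⊆-antisym f g x = T-injective (f x) (g x)

∪-least : ∀ X Y Z → X ⊆ Z → Y ⊆ Z → (X ∪ˢ Y) ⊆ Z
∪-least X Y Z f g x p with T-∨⁻ {X x} p
... | inj₁ q = f x q
... | inj₂ q = g x q

X⊆X∪Y : ∀ X Y → X ⊆ (X ∪ˢ Y)
X⊆X∪Y X Y x p = T-∨⁺ˡ p

Y⊆X∪Y : ∀ X Y → Y ⊆ (X ∪ˢ Y)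
Y⊆X∪Y X Y x p = T-∨⁺ʳ {X x} p

∩-greatest : ∀ X Y Z → X ⊆ Y → X ⊆ Z → X ⊆ (Y ∩ˢ Z)
∩-greatest X Y Z f g x p = T-∧⁺ (f x p) (g x p)

X∩Y⊆X : ∀ X Y → (X ∩ˢ Y) ⊆ X
X∩Y⊆X X Y x p = T-∧⁻ˡ p

X∩Y⊆Y : ∀ X Y → (X ∩ˢ Y) ⊆ Y
X∩Y⊆Y X Y x p = T-∧⁻ʳ {X x} p

X∖Y⊆X : ∀ X Y → (X ∖ˢ Y) ⊆ X
X∖Y⊆X X Y x p = T-∧⁻ˡ p

｛｝⊆ : ∀ {e X} → T (X e) → ｛ e ｝ ⊆ X
｛｝⊆ {e} {X} p x q = subst (λ z → T (X z)) (sym (T-≡ᵇ⁻ q)) p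

⊆-∪∖ : ∀ X Z → X ⊆ (Z ∪ˢ (X ∖ˢ Z))
⊆-∪∖ X Z x p with Z x
... | true = tt
... | false = T-∧⁺ {X x} {true} p tt

∪-cong≐ : ∀ {X Y} (Z : Sub) → X ≐ Y → (X ∪ˢ Z) ≐ (Y ∪ˢ Z)
∪-cong≐ Z e x = cong (_∨ Z x) (e x)

∪-swapʳ : ∀ Y A B → ((Y ∪ˢ A) ∪ˢ B) ≐ ((Y ∪ˢ B) ∪ˢ A)
∪-swapʳ Y A B x with Y x | A x | B x
... | true | a | b = refl
... | false | true | true = refl
... | false | true | false = refl
... | false | false | true = refl
... | false | false | false = refl

∩-distribʳ-∪ : ∀ E X Y → ((X ∪ˢ Y) ∩ˢ E) ≐ ((X ∩ˢ E) ∪ˢ (Y ∩ˢ E))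
∩-distribʳ-∪ E X Y x = ∧-distribʳ-∨ (E x) (X x) (Y x)

∩-distribʳ-∩ : ∀ E X Y → ((X ∩ˢ Y) ∩ˢ E) ≐ ((X ∩ˢ E) ∩ˢ (Y ∩ˢ E))
∩-distribʳ-∩ E X Y x with X x | E x
... | false | _ = refl
... | true | true = refl
... | true | false = ∧-zeroʳ (Y x)

∪-distribʳ-∪ : ∀ C X Y → ((X ∪ˢ Y) ∪ˢ C) ≐ ((X ∪ˢ C) ∪ˢ (Y ∪ˢ C))
∪-distribʳ-∪ C X Y x with X x | C x
... | true | _ = refl
... | false | true = ∨-zeroʳ (Y x)
... | false | false = refl

∪-distribʳ-∩ : ∀ C X Y → ((X ∩ˢ Y) ∪ˢ C) ≐ ((X ∪ˢ C) ∩ˢ (Y ∪ˢ C))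
∪-distribʳ-∩ C X Y x = ∨-distribʳ-∧ (C x) (X x) (Y x)

∈ᵇ-here : ∀ x y l → x ≡ y → T (x ∈ᵇ (y ∷ l))
∈ᵇ-here x y l refl = T-∨⁺ˡ (T-≡ᵇ-refl x)

∈ᵇ-there : ∀ x y l → T (x ∈ᵇ l) → T (x ∈ᵇ (y ∷ l))
∈ᵇ-there x y l p = T-∨⁺ʳ p

∈ᵇ-∷⁻ : ∀ x y l → T (x ∈ᵇ (y ∷ l)) → x ≡ y ⊎ T (x ∈ᵇ l)
∈ᵇ-∷⁻ x y l p with T-∨⁻ {x ≡ᵇ y} p
... | inj₁ q = inj₁ (T-≡ᵇ⁻ q)
... | inj₂ q = inj₂ q

∈ᵇ-++⁺ˡ : ∀ x l l' → T (x ∈ᵇ l) → T (x ∈ᵇ (l ++ l'))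
∈ᵇ-++⁺ˡ x [] l' ()
∈ᵇ-++⁺ˡ x (y ∷ l) l' p with ∈ᵇ-∷⁻ x y l p
... | inj₁ e = ∈ᵇ-here x y (l ++ l') e
... | inj₂ q = ∈ᵇ-there x y (l ++ l') (∈ᵇ-++⁺ˡ x l l' q)

∈ᵇ-++⁺ʳ : ∀ x l l' → T (x ∈ᵇ l') → T (x ∈ᵇ (l ++ l'))
∈ᵇ-++⁺ʳ x [] l' p = p
∈ᵇ-++⁺ʳ x (y ∷ l) l' p = ∈ᵇ-there x y (l ++ l') (∈ᵇ-++⁺ʳ x l l' p)

∈ᵇ-++⁻ : ∀ x l l' → T (x ∈ᵇ (l ++ l')) → T (x ∈ᵇ l) ⊎ T (x ∈ᵇ l')
∈ᵇ-++⁻ x [] l' p = inj₂ p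
∈ᵇ-++⁻ x (y ∷ l) l' p with ∈ᵇ-∷⁻ x y (l ++ l') p
... | inj₁ e = inj₁ (∈ᵇ-here x y l e)
... | inj₂ q with ∈ᵇ-++⁻ x l l' q
... | inj₁ r = inj₁ (∈ᵇ-there x y l r)
... | inj₂ r = inj₂ r

∈ᵇ-map⁺ : ∀ x (f : ℕ → ℕ) l → T (x ∈ᵇ l) → T (f x ∈ᵇ map f l)
∈ᵇ-map⁺ x f [] ()
∈ᵇ-map⁺ x f (y ∷ l) p with ∈ᵇ-∷⁻ x y l p
... | inj₁ refl = ∈ᵇ-here (f x) (f x) (map f l) refl
... | inj₂ q = ∈ᵇ-there (f x) (f y) (map f l) (∈ᵇ-map⁺ x f l q)

∈ᵇ-map⁻ : ∀ z (f : ℕ → ℕ) l → T (z ∈ᵇ map f l) → Σ ℕ λ x → T (x ∈ᵇ l) × z ≡ f x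
∈ᵇ-map⁻ z f [] ()
∈ᵇ-map⁻ z f (y ∷ l) p with ∈ᵇ-∷⁻ z (f y) (map f l) p
... | inj₁ e = y , ∈ᵇ-here y y l refl , e
... | inj₂ q with ∈ᵇ-map⁻ z f l q
... | x , m , e = x , ∈ᵇ-there x y l m , e

any⁻ : ∀ (p : ℕ → Bool) ts → T (any p ts) → Σ ℕ λ t → T (t ∈ᵇ ts) × T (p t)
any⁻ p [] ()
any⁻ p (t ∷ ts) h with T-∨⁻ {p t} {any p ts} h
... | inj₁ a = t , ∈ᵇ-here t t ts refl , a
... | inj₂ b with any⁻ p ts b
... | u , m , c = u , ∈ᵇ-there u t ts m , c

any⁺ : ∀ (p : ℕ → Bool) ts t → T (t ∈ᵇ ts) → T (p t) → T (any p ts)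
any⁺ p [] t ()
any⁺ p (u ∷ ts) t m h with ∈ᵇ-∷⁻ t u ts m
... | inj₁ refl = T-∨⁺ˡ {p t} {any p ts} h
... | inj₂ m' = T-∨⁺ʳ {p u} {any p ts} (any⁺ p ts t m' h)

any≡⁻ : ∀ (f : ℕ → ℕ) ts x → T (any (λ t → f t ≡ᵇ x) ts) → Σ ℕ λ t → T (t ∈ᵇ ts) × f t ≡ x
any≡⁻ f [] x ()
any≡⁻ f (t ∷ ts) x p with T-∨⁻ {f t ≡ᵇ x} {any (λ t → f t ≡ᵇ x) ts} p
... | inj₁ h = t , ∈ᵇ-here t t ts refl , T-≡ᵇ⁻ {f t} {x} h
... | inj₂ h with any≡⁻ f ts x h
... | u , m , e = u , ∈ᵇ-there u t ts m , e

any≡⁺ : ∀ (f : ℕ → ℕ) ts t → T (t ∈ᵇ ts) → T (any (λ u → f u ≡ᵇ f t) ts)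
any≡⁺ f [] t ()
any≡⁺ f (u ∷ ts) t m with ∈ᵇ-∷⁻ t u ts m
... | inj₁ refl = T-∨⁺ˡ {f t ≡ᵇ f t} (T-≡ᵇ-refl (f t))
... | inj₂ h = T-∨⁺ʳ {f u ≡ᵇ f t} (any≡⁺ f ts t h)

module _ {P : Pred ℕ 0ℓ} (P? : Decidable P) where

  ∈ᵇ-filter⁻ : ∀ x l → T (x ∈ᵇ filter P? l) → T (x ∈ᵇ l)
  ∈ᵇ-filter⁻ x [] ()
  ∈ᵇ-filter⁻ x (y ∷ l) p with P? y
  ... | yes _ with ∈ᵇ-∷⁻ x y (filter P? l) p
  ... | inj₁ e = ∈ᵇ-here x y l e
  ... | inj₂ q = ∈ᵇ-there x y l (∈ᵇ-filter⁻ x l q)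
  ∈ᵇ-filter⁻ x (y ∷ l) p | no _ = ∈ᵇ-there x y l (∈ᵇ-filter⁻ x l p)

  ∈ᵇ-filter⇒P : ∀ x l → T (x ∈ᵇ filter P? l) → P x
  ∈ᵇ-filter⇒P x [] ()
  ∈ᵇ-filter⇒P x (y ∷ l) p with P? y
  ... | yes py with ∈ᵇ-∷⁻ x y (filter P? l) p
  ... | inj₁ refl = py
  ... | inj₂ q = ∈ᵇ-filter⇒P x l q
  ∈ᵇ-filter⇒P x (y ∷ l) p | no _ = ∈ᵇ-filter⇒P x l p

  ∈ᵇ-filter⁺ : ∀ x l → T (x ∈ᵇ l) → P x → T (x ∈ᵇ filter P? l)
  ∈ᵇ-filter⁺ x [] () _
  ∈ᵇ-filter⁺ x (y ∷ l) m px with ∈ᵇ-∷⁻ x y l m | P? y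
  ... | inj₁ refl | yes _ = ∈ᵇ-here x x (filter P? l) refl
  ... | inj₁ refl | no ¬p = ⊥-elim (¬p px)
  ... | inj₂ q | yes _ = ∈ᵇ-there x y (filter P? l) (∈ᵇ-filter⁺ x l q px)
  ... | inj₂ q | no _ = ∈ᵇ-filter⁺ x l q px

Distinct : List ℕ → Set
Distinct [] = ⊤
Distinct (x ∷ l) = ¬ T (x ∈ᵇ l) × Distinct l

Distinct-filter : ∀ {P : Pred ℕ 0ℓ} (P? : Decidable P) l → Distinct l → Distinct (filter P? l)
Distinct-filter P? [] u = tt
Distinct-filter P? (y ∷ l) (n , u) with P? y
... | yes _ = (λ m → n (∈ᵇ-filter⁻ P? y l m)) , Distinct-filter P? l u
... | no _ = Distinct-filter P? l u

rm? : ∀ x → Decidable (_≢ x)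
rm? x y with y ≟ x
... | yes e = no (λ f → f e)
... | no f = yes f

rm : ℕ → List ℕ → List ℕ
rm x = filter (rm? x)

length-rm< : ∀ x l → T (x ∈ᵇ l) → suc (length (rm x l)) ≤ length l
length-rm< x [] ()
length-rm< x (y ∷ l) m with y ≟ x | ∈ᵇ-∷⁻ x y l m
... | yes refl | _ = s≤s (length-filter (rm? x) l)
... | no f | inj₁ refl = ⊥-elim (f refl)
... | no f | inj₂ q = s≤s (length-rm< x l q)

Distinct-⊆⇒length≤ : ∀ l l' → Distinct l → ⟦ l ⟧ ⊆ ⟦ l' ⟧ → length l ≤ length l'
Distinct-⊆⇒length≤ [] l' _ _ = z≤n
Distinct-⊆⇒length≤ (x ∷ l) l' (n , u) sub =
  ≤-trans (s≤s (Distinct-⊆⇒length≤ l (rm x l') u sub')) (length-rm< x l' (sub x (∈ᵇ-here x x l refl)))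
  where
  sub' : ⟦ l ⟧ ⊆ ⟦ rm x l' ⟧
  sub' y m = ∈ᵇ-filter⁺ (rm? x) y l' (sub y (∈ᵇ-there y x l m)) (λ { refl → n m })

Distinct-≐⇒length≡ : ∀ l l' → Distinct l → Distinct l' → ⟦ l ⟧ ⊆ ⟦ l' ⟧ → ⟦ l' ⟧ ⊆ ⟦ l ⟧ →
                     length l ≡ length l'
Distinct-≐⇒length≡ l l' u u' f g = ≤-antisym (Distinct-⊆⇒length≤ l l' u f) (Distinct-⊆⇒length≤ l' l u' g)

dedup : List ℕ → List ℕ
dedup = deduplicateᵇ _≡ᵇ_

≢ᵇ? : ∀ y → Decidable (λ z → ¬ T (y ≡ᵇ z))
≢ᵇ? y z = ¬? (T? (y ≡ᵇ z))

∈ᵇ-dedup⁻ : ∀ x l → T (x ∈ᵇ dedup l) → T (x ∈ᵇ l)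
∈ᵇ-dedup⁻ x [] ()
∈ᵇ-dedup⁻ x (y ∷ l) p with ∈ᵇ-∷⁻ x y (filter (≢ᵇ? y) (dedup l)) p
... | inj₁ e = ∈ᵇ-here x y l e
... | inj₂ q = ∈ᵇ-there x y l (∈ᵇ-dedup⁻ x l (∈ᵇ-filter⁻ (≢ᵇ? y) x (dedup l) q))

∈ᵇ-dedup⁺ : ∀ x l → T (x ∈ᵇ l) → T (x ∈ᵇ dedup l)
∈ᵇ-dedup⁺ x [] ()
∈ᵇ-dedup⁺ x (y ∷ l) p with x ≟ y
... | yes e = ∈ᵇ-here x y (filter (≢ᵇ? y) (dedup l)) e
... | no f with ∈ᵇ-∷⁻ x y l p
... | inj₁ e = ⊥-elim (f e)
... | inj₂ q = ∈ᵇ-there x y (filter (≢ᵇ? y) (dedup l)) (∈ᵇ-filter⁺ (≢ᵇ? y) x (dedup l) (∈ᵇ-dedup⁺ x l q) (λ t → f (sym (T-≡ᵇ⁻ t))))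

Distinct-dedup : ∀ l → Distinct (dedup l)
Distinct-dedup [] = tt
Distinct-dedup (y ∷ l) = (λ m → ∈ᵇ-filter⇒P (≢ᵇ? y) y (dedup l) m (T-≡ᵇ-refl y)) , Distinct-filter (≢ᵇ? y) (dedup l) (Distinct-dedup l)

∈ᵇ-filterᵇ⁻ : ∀ (p : Sub) x l → T (x ∈ᵇ filterᵇ p l) → T (x ∈ᵇ l)
∈ᵇ-filterᵇ⁻ p = ∈ᵇ-filter⁻ (T? ∘ p)

∈ᵇ-filterᵇ⇒p : ∀ (p : Sub) x l → T (x ∈ᵇ filterᵇ p l) → T (p x)
∈ᵇ-filterᵇ⇒p p = ∈ᵇ-filter⇒P (T? ∘ p)

∈ᵇ-filterᵇ⁺ : ∀ (p : Sub) x l → T (x ∈ᵇ l) → T (p x) → T (x ∈ᵇ filterᵇ p l)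
∈ᵇ-filterᵇ⁺ p = ∈ᵇ-filter⁺ (T? ∘ p)

Distinct-filterᵇ : ∀ (p : Sub) l → Distinct l → Distinct (filterᵇ p l)
Distinct-filterᵇ p = Distinct-filter (T? ∘ p)

card-≤ : ∀ E E' X X' → (∀ x → T (x ∈ᵇ E) → T (X x) → T (x ∈ᵇ E') × T (X' x)) →
          card E X ≤ card E' X'
card-≤ E E' X X' f = Distinct-⊆⇒length≤ (dedup (filterᵇ X E)) (dedup (filterᵇ X' E')) (Distinct-dedup (filterᵇ X E)) g
  where
  g : ⟦ dedup (filterᵇ X E) ⟧ ⊆ ⟦ dedup (filterᵇ X' E') ⟧
  g x m with ∈ᵇ-dedup⁻ x (filterᵇ X E) m
  ... | m' with f x (∈ᵇ-filterᵇ⁻ X x E m') (∈ᵇ-filterᵇ⇒p X x E m')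
  ... | a , b = ∈ᵇ-dedup⁺ x (filterᵇ X' E') (∈ᵇ-filterᵇ⁺ X' x E' a b)

card-≡ : ∀ E E' X X' → (∀ x → T (x ∈ᵇ E) → T (X x) → T (x ∈ᵇ E') × T (X' x)) →
          (∀ x → T (x ∈ᵇ E') → T (X' x) → T (x ∈ᵇ E) × T (X x)) →
          card E X ≡ card E' X'
card-≡ E E' X X' f g = ≤-antisym (card-≤ E E' X X' f) (card-≤ E' E X' X g)

card-cong : ∀ E X Y → (∀ x → T (x ∈ᵇ E) → T (X x) → T (Y x)) →
           (∀ x → T (x ∈ᵇ E) → T (Y x) → T (X x)) → card E X ≡ card E Y
card-cong E X Y f g = card-≡ E E X Y (λ x a b → a , f x a b) (λ x a b → a , g x a b)

count : List ℕ → Sub → ℕ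
count U X = length (filterᵇ X U)

card≡count : ∀ E X → card E X ≡ count (dedup E) X
card≡count E X = Distinct-≐⇒length≡ (dedup (filterᵇ X E)) (filterᵇ X (dedup E)) (Distinct-dedup (filterᵇ X E)) (Distinct-filterᵇ X (dedup E) (Distinct-dedup E)) f g
  where
  f : ⟦ dedup (filterᵇ X E) ⟧ ⊆ ⟦ filterᵇ X (dedup E) ⟧
  f x m = let m' = ∈ᵇ-dedup⁻ x (filterᵇ X E) m in
          ∈ᵇ-filterᵇ⁺ X x (dedup E) (∈ᵇ-dedup⁺ x E (∈ᵇ-filterᵇ⁻ X x E m')) (∈ᵇ-filterᵇ⇒p X x E m')
  g : ⟦ filterᵇ X (dedup E) ⟧ ⊆ ⟦ dedup (filterᵇ X E) ⟧
  g x m = ∈ᵇ-dedup⁺ x (filterᵇ X E) (∈ᵇ-filterᵇ⁺ X x E (∈ᵇ-dedup⁻ x E (∈ᵇ-filterᵇ⁻ X x (dedup E) m)) (∈ᵇ-filterᵇ⇒p X x (dedup E) m))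

count-modular : ∀ U X Y → count U (X ∪ˢ Y) + count U (X ∩ˢ Y) ≡ count U X + count U Y
count-modular [] X Y = refl
count-modular (u ∷ U) X Y with X u | Y u
... | true | true = trans (cong suc (+-suc (count U (X ∪ˢ Y)) (count U (X ∩ˢ Y))))
                    (trans (cong (λ z → suc (suc z)) (count-modular U X Y)) (sym (cong suc (+-suc (count U X) (count U Y)))))
... | true | false = cong suc (count-modular U X Y)
... | false | true = trans (cong suc (count-modular U X Y)) (sym (+-suc (count U X) (count U Y)))
... | false | false = count-modular U X Y

card-modular : ∀ E X Y → card E (X ∪ˢ Y) + card E (X ∩ˢ Y) ≡ card E X + card E Y
card-modular E X Y rewrite card≡count E (X ∪ˢ Y) | card≡count E (X ∩ˢ Y) | card≡count E X | card≡count E Y =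
  count-modular (dedup E) X Y

card-∅ : ∀ E → card E ∅ˢ ≡ 0
card-∅ [] = refl
card-∅ (x ∷ E) = card-∅ E

card-∖-split : ∀ E X Z → Z ⊆ X → card E Z + card E (X ∖ˢ Z) ≡ card E X
card-∖-split E X Z zx = begin
  card E Z + card E (X ∖ˢ Z)                          ≡⟨ sym (card-modular E Z (X ∖ˢ Z)) ⟩
  card E (Z ∪ˢ (X ∖ˢ Z)) + card E (Z ∩ˢ (X ∖ˢ Z))    ≡⟨ cong₂ _+_ union (trans disjoint (card-∅ E)) ⟩
  card E X + 0                                        ≡⟨ +-identityʳ _ ⟩
  card E X                                            ∎
  where
  open ≡-Reasoning
  union : card E (Z ∪ˢ (X ∖ˢ Z)) ≡ card E X
  union = card-cong E _ X (λ x _ p → [ zx x , X∖Y⊆X X Z x ]′ (T-∨⁻ {Z x} p)) (λ x _ p → ⊆-∪∖ X Z x p)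
  disjoint : card E (Z ∩ˢ (X ∖ˢ Z)) ≡ card E ∅ˢ
  disjoint = card-cong E _ ∅ˢ (λ x _ p → T-not⁻ (T-∧⁻ʳ {X x} (T-∧⁻ʳ {Z x} p)) (T-∧⁻ˡ p)) (λ _ _ ())

card-｛｝ : ∀ E e → T (e ∈ᵇ E) → card E ｛ e ｝ ≡ 1
card-｛｝ E e m = card-≡ E (e ∷ []) ｛ e ｝ (λ _ → true) f g
  where
  f : ∀ x → T (x ∈ᵇ E) → T (｛ e ｝ x) → T (x ∈ᵇ (e ∷ [])) × T true
  f x _ q = ∈ᵇ-here x e [] (T-≡ᵇ⁻ q) , tt
  g : ∀ x → T (x ∈ᵇ (e ∷ [])) → T true → T (x ∈ᵇ E) × T (｛ e ｝ x)
  g x p _ with ∈ᵇ-∷⁻ x e [] p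
  ... | inj₁ refl = m , T-≡ᵇ-refl x
  ... | inj₂ ()

card-++ : ∀ A B Y → (∀ x → T (x ∈ᵇ A) → ¬ T (x ∈ᵇ B)) →
          card (A ++ B) Y ≡ card A Y + card B Y
card-++ A B Y disj = begin
    card (A ++ B) Y ≡⟨ sym e1 ⟩
    card (A ++ B) (Y₁ ∪ˢ Y₂) ≡⟨ sym (+-identityʳ _) ⟩
    card (A ++ B) (Y₁ ∪ˢ Y₂) + 0 ≡⟨ cong (card (A ++ B) (Y₁ ∪ˢ Y₂) +_) (sym e0) ⟩
    card (A ++ B) (Y₁ ∪ˢ Y₂) + card (A ++ B) (Y₁ ∩ˢ Y₂) ≡⟨ m ⟩
    card (A ++ B) Y₁ + card (A ++ B) Y₂ ≡⟨ cong₂ _+_ eA eB ⟩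
    card A Y + card B Y ∎
  where
  open ≡-Reasoning
  Y₁ = Y ∩ˢ ⟦ A ⟧
  Y₂ = Y ∩ˢ ⟦ B ⟧
  m = card-modular (A ++ B) Y₁ Y₂
  e0 : card (A ++ B) (Y₁ ∩ˢ Y₂) ≡ 0
  e0 = trans (card-cong (A ++ B) (Y₁ ∩ˢ Y₂) ∅ˢ
               (λ x _ p → disj x (T-∧⁻ʳ (T-∧⁻ˡ {Y₁ x} p)) (T-∧⁻ʳ (T-∧⁻ʳ {Y₁ x} p))) (λ _ _ ()))
             (card-∅ (A ++ B))
  e1 : card (A ++ B) (Y₁ ∪ˢ Y₂) ≡ card (A ++ B) Y
  e1 = card-cong (A ++ B) (Y₁ ∪ˢ Y₂) Y
        (λ x _ p → [ (λ q → T-∧⁻ˡ q) , (λ q → T-∧⁻ˡ q) ]′ (T-∨⁻ {Y₁ x} p))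
        (λ x m p → [ (λ q → T-∨⁺ˡ (T-∧⁺ p q)) , (λ q → T-∨⁺ʳ {Y₁ x} (T-∧⁺ p q)) ]′ (∈ᵇ-++⁻ x A B m))
  eA : card (A ++ B) Y₁ ≡ card A Y
  eA = card-≡ (A ++ B) A Y₁ Y (λ x _ p → T-∧⁻ʳ p , T-∧⁻ˡ p) (λ x m p → ∈ᵇ-++⁺ˡ x A B m , T-∧⁺ p m)
  eB : card (A ++ B) Y₂ ≡ card B Y
  eB = card-≡ (A ++ B) B Y₂ Y (λ x _ p → T-∧⁻ʳ p , T-∧⁻ˡ p) (λ x m p → ∈ᵇ-++⁺ʳ x A B m , T-∧⁺ p m)

InjOn : (ℕ → ℕ) → List ℕ → Set
InjOn φ G = ∀ x x' → T (x ∈ᵇ G) → T (x' ∈ᵇ G) → φ x ≡ φ x' → x ≡ x'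

Distinct-map : ∀ φ L G → ⟦ L ⟧ ⊆ ⟦ G ⟧ → InjOn φ G → Distinct L → Distinct (map φ L)
Distinct-map φ [] G s inj u = tt
Distinct-map φ (y ∷ L) G s inj (n , u) =
  (λ m → let (x , mx , e) = ∈ᵇ-map⁻ (φ y) φ L m in
         n (subst (λ z → T (z ∈ᵇ L)) (sym (inj y x (s y (∈ᵇ-here y y L refl)) (s x (∈ᵇ-there x y L mx)) e)) mx)) ,
  Distinct-map φ L G (λ x m → s x (∈ᵇ-there x y L m)) inj u

card-map : ∀ φ G Y → InjOn φ G → card (map φ G) Y ≡ card G (λ x → Y (φ x))
card-map φ G Y inj =
  trans (Distinct-≐⇒length≡ (dedup (filterᵇ Y (map φ G))) (map φ L) (Distinct-dedup (filterᵇ Y (map φ G)))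
           (Distinct-map φ L G (λ x m → ∈ᵇ-filterᵇ⁻ Yφ x G (∈ᵇ-dedup⁻ x (filterᵇ Yφ G) m)) inj (Distinct-dedup (filterᵇ Yφ G))) f g)
        (length-map φ L)
  where
  Yφ : Sub
  Yφ x = Y (φ x)
  L = dedup (filterᵇ Yφ G)
  f : ⟦ dedup (filterᵇ Y (map φ G)) ⟧ ⊆ ⟦ map φ L ⟧
  f z m with ∈ᵇ-dedup⁻ z (filterᵇ Y (map φ G)) m
  ... | m' with ∈ᵇ-map⁻ z φ G (∈ᵇ-filterᵇ⁻ Y z (map φ G) m')
  ... | x , mx , refl = ∈ᵇ-map⁺ x φ L (∈ᵇ-dedup⁺ x (filterᵇ Yφ G) (∈ᵇ-filterᵇ⁺ Yφ x G mx (∈ᵇ-filterᵇ⇒p Y (φ x) (map φ G) m')))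
  g : ⟦ map φ L ⟧ ⊆ ⟦ dedup (filterᵇ Y (map φ G)) ⟧
  g z m with ∈ᵇ-map⁻ z φ L m
  ... | x , mx , refl with ∈ᵇ-dedup⁻ x (filterᵇ Yφ G) mx
  ... | m' = ∈ᵇ-dedup⁺ (φ x) (filterᵇ Y (map φ G)) (∈ᵇ-filterᵇ⁺ Y (φ x) (map φ G) (∈ᵇ-map⁺ x φ G (∈ᵇ-filterᵇ⁻ Yφ x G m')) (∈ᵇ-filterᵇ⇒p Yφ x G m'))

subsetᵇ⁻ : ∀ E X C → T (subsetᵇ E X C) → ∀ e → T (e ∈ᵇ E) → T (X e) → T (C e)
subsetᵇ⁻ [] X C p e () _
subsetᵇ⁻ (y ∷ E) X C p e m xe with ∈ᵇ-∷⁻ e y E m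
... | inj₁ refl = [ (λ q → ⊥-elim (T-not⁻ q xe)) , (λ q → q) ]′ (T-∨⁻ {not (X e)} (T-∧⁻ˡ p))
... | inj₂ q = subsetᵇ⁻ E X C (T-∧⁻ʳ {not (X y) ∨ C y} p) e q xe

subsetᵇ⁺ : ∀ E X C → (∀ e → T (e ∈ᵇ E) → T (X e) → T (C e)) → T (subsetᵇ E X C)
subsetᵇ⁺ [] X C f = tt
subsetᵇ⁺ (y ∷ E) X C f = T-∧⁺ h (subsetᵇ⁺ E X C (λ e m → f e (∈ᵇ-there e y E m)))
  where
  h : T (not (X y) ∨ C y)
  h with T-dec (X y)
  ... | inj₁ xy = T-∨⁺ʳ {not (X y)} (f y (∈ᵇ-here y y E refl) xy)
  ... | inj₂ nxy = T-∨⁺ˡ (T-not⁺ nxy)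

a+c≤b+d∧b≤c⇒a≤d : ∀ {a b c d} → a + c ≤ b + d → b ≤ c → a ≤ d
a+c≤b+d∧b≤c⇒a≤d {a} {b} {c} {d} h bc = +-cancelʳ-≤ b a d
  (≤-trans (+-monoʳ-≤ a bc) (≤-trans h (≤-reflexive (+-comm b d))))

a+c≤b+d∧b≤a⇒c≤d : ∀ {a b c d} → a + c ≤ b + d → b ≤ a → c ≤ d
a+c≤b+d∧b≤a⇒c≤d {a} {b} {c} {d} h ba = a+c≤b+d∧b≤c⇒a≤d {c} {b} {a} {d} (≤-trans (≤-reflexive (+-comm c a)) h) ba

∸-sum-mono-≤ : ∀ a b a' b' c → c ≤ a → c ≤ b → c ≤ a' → c ≤ b' → a + b ≤ a' + b' →
      (a ∸ c) + (b ∸ c) ≤ (a' ∸ c) + (b' ∸ c)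
∸-sum-mono-≤ a b a' b' c ca cb ca' cb' le = +-cancelʳ-≤ (c + c) _ _
  (subst₂ _≤_ (sym (e a b ca cb)) (sym (e a' b' ca' cb')) le)
  where
  e : ∀ x y → c ≤ x → c ≤ y → (x ∸ c) + (y ∸ c) + (c + c) ≡ x + y
  e x y cx cy = trans (+-interchange (x ∸ c) (y ∸ c) c c) (cong₂ _+_ (m∸n+n≡m cx) (m∸n+n≡m cy))

+-rotate : ∀ a b c d → a + b + (c + d) ≡ c + b + a + d
+-rotate = solve-∀

-- Rank functions

module Rank (L : RawMatroid) (m : IsMatroid L) where
  open IsMatroid m

  G : Sub
  G = ⟦ ground L ⟧

  r : Sub → ℕ
  r = rank L

  rank-cong : ∀ {X Y} → X ⊆ G → X ⊆ Y → Y ⊆ X → r X ≡ r Y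
  rank-cong {X} {Y} xg f g = r-ext X Y xg (⊆-antisym f g)

  rank-mono : ∀ {X Y} → X ⊆ Y → Y ⊆ G → r X ≤ r Y
  rank-mono {X} {Y} = r-mono X Y

  rank-submod : ∀ {X Y} → X ⊆ G → Y ⊆ G → r (X ∪ˢ Y) + r (X ∩ˢ Y) ≤ r X + r Y
  rank-submod {X} {Y} = r-submod X Y

  rank-subadd : ∀ {X Y} → X ⊆ G → Y ⊆ G → r (X ∪ˢ Y) ≤ r X + r Y
  rank-subadd xg yg = ≤-trans (m≤m+n _ _) (rank-submod xg yg)

  rank-empty : ∀ {X} → X ⊆ G → (∀ x → ¬ T (X x)) → r X ≡ 0
  rank-empty {X} xg n = n≤0⇒n≡0 (≤-trans (r-bound X xg)
     (≤-reflexive (trans (card-cong (ground L) X ∅ˢ (λ x _ p → n x p) (λ _ _ ())) (card-∅ (ground L)))))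

  rank≤card : ∀ {X} → X ⊆ G → r X ≤ card (ground L) X
  rank≤card {X} = r-bound X

  rank-absorb↑ : ∀ {Y Z F} → Y ⊆ Z → Z ⊆ G → F ⊆ G → r (Y ∪ˢ F) ≡ r Y → r (Z ∪ˢ F) ≡ r Z
  rank-absorb↑ {Y} {Z} {F} yz zg fg e = ≤-antisym le (rank-mono (X⊆X∪Y Z F) (∪-least Z F G zg fg))
    where
    yg = ⊆-trans Y Z G yz zg
    submod : r (Z ∪ˢ (Y ∪ˢ F)) + r (Z ∩ˢ (Y ∪ˢ F)) ≤ r Z + r (Y ∪ˢ F)
    submod = rank-submod zg (∪-least Y F G yg fg)
    Z∪F≐ : r (Z ∪ˢ F) ≡ r (Z ∪ˢ (Y ∪ˢ F))
    Z∪F≐ = rank-cong (∪-least Z F G zg fg) (λ x p → [ (λ q → T-∨⁺ˡ q) , (λ q → T-∨⁺ʳ {Z x} (T-∨⁺ʳ {Y x} q)) ]′ (T-∨⁻ {Z x} p))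
            (λ x p → [ (λ q → T-∨⁺ˡ q) , (λ q → [ (λ q' → T-∨⁺ˡ (yz x q')) , (λ q' → T-∨⁺ʳ {Z x} q') ]′ (T-∨⁻ {Y x} q)) ]′ (T-∨⁻ {Z x} p))
    rY≤ : r Y ≤ r (Z ∩ˢ (Y ∪ˢ F))
    rY≤ = rank-mono (∩-greatest Y Z (Y ∪ˢ F) yz (X⊆X∪Y Y F)) (⊆-trans (Z ∩ˢ (Y ∪ˢ F)) Z G (X∩Y⊆X Z (Y ∪ˢ F)) zg)
    sum≤ : r (Z ∪ˢ F) + r (Z ∩ˢ (Y ∪ˢ F)) ≤ r Y + r Z
    sum≤ = begin
      r (Z ∪ˢ F) + r (Z ∩ˢ (Y ∪ˢ F)) ≡⟨ cong (_+ r (Z ∩ˢ (Y ∪ˢ F))) Z∪F≐ ⟩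
      r (Z ∪ˢ (Y ∪ˢ F)) + r (Z ∩ˢ (Y ∪ˢ F)) ≤⟨ submod ⟩
      r Z + r (Y ∪ˢ F) ≡⟨ cong (r Z +_) e ⟩
      r Z + r Y ≡⟨ +-comm (r Z) (r Y) ⟩
      r Y + r Z ∎
      where open ≤-Reasoning
    le : r (Z ∪ˢ F) ≤ r Z
    le = a+c≤b+d∧b≤c⇒a≤d {r (Z ∪ˢ F)} {r Y} {r (Z ∩ˢ (Y ∪ˢ F))} {r Z} sum≤ rY≤

  rank-absorb↓ : ∀ {Y Z F} → Y ⊆ Z → Z ⊆ G → F ⊆ G → r Y ≡ r Z → r (Z ∪ˢ F) ≡ r Z → r (Y ∪ˢ F) ≡ r Y
  rank-absorb↓ {Y} {Z} {F} yz zg fg e1 e2 = ≤-antisym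
    (≤-trans (rank-mono (∪-least Y F (Z ∪ˢ F) (⊆-trans Y Z (Z ∪ˢ F) yz (X⊆X∪Y Z F)) (Y⊆X∪Y Z F)) (∪-least Z F G zg fg))
             (≤-reflexive (trans e2 (sym e1))))
    (rank-mono (X⊆X∪Y Y F) (∪-least Y F G (⊆-trans Y Z G yz zg) fg))

  rank-absorb∩ : ∀ {A B F} → A ⊆ G → B ⊆ G → F ⊆ G → r (A ∪ˢ B) + r (A ∩ˢ B) ≡ r A + r B →
            r (A ∪ˢ F) ≡ r A → r (B ∪ˢ F) ≡ r B → r ((A ∩ˢ B) ∪ˢ F) ≡ r (A ∩ˢ B)
  rank-absorb∩ {A} {B} {F} ag bg fg mod ea eb = ≤-antisym le (rank-mono (X⊆X∪Y (A ∩ˢ B) F) (∪-least (A ∩ˢ B) F G (⊆-trans (A ∩ˢ B) A G (X∩Y⊆X A B) ag) fg))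
    where
    A' = A ∪ˢ F
    B' = B ∪ˢ F
    a'g = ∪-least A F G ag fg
    b'g = ∪-least B F G bg fg
    submod : r (A' ∪ˢ B') + r (A' ∩ˢ B') ≤ r (A ∪ˢ B) + r (A ∩ˢ B)
    submod = subst (λ z → r (A' ∪ˢ B') + r (A' ∩ˢ B') ≤ z) (trans (cong₂ _+_ ea eb) (sym mod)) (rank-submod a'g b'g)
    r∪≤ : r (A ∪ˢ B) ≤ r (A' ∪ˢ B')
    r∪≤ = rank-mono (∪-least A B (A' ∪ˢ B') (⊆-trans A A' (A' ∪ˢ B') (X⊆X∪Y A F) (X⊆X∪Y A' B'))
                                (⊆-trans B B' (A' ∪ˢ B') (X⊆X∪Y B F) (Y⊆X∪Y A' B')))
            (∪-least A' B' G a'g b'g)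
    le : r ((A ∩ˢ B) ∪ˢ F) ≤ r (A ∩ˢ B)
    le = ≤-trans (rank-mono (∪-least (A ∩ˢ B) F (A' ∩ˢ B')
                        (∩-greatest (A ∩ˢ B) A' B' (⊆-trans (A ∩ˢ B) A A' (X∩Y⊆X A B) (X⊆X∪Y A F))
                                          (⊆-trans (A ∩ˢ B) B B' (X∩Y⊆Y A B) (X⊆X∪Y B F)))
                        (∩-greatest F A' B' (Y⊆X∪Y A F) (Y⊆X∪Y B F)))
                     (⊆-trans (A' ∩ˢ B') A' G (X∩Y⊆X A' B') a'g))
                 (a+c≤b+d∧b≤a⇒c≤d {r (A' ∪ˢ B')} {r (A ∪ˢ B)} submod r∪≤)

  Indep-⊆ : ∀ {X Z} → Indep L X → Z ⊆ X → Indep L Z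
  Indep-⊆ {X} {Z} (xg , ix) zx = zg , ≤-antisym (rank≤card zg) (+-cancelʳ-≤ (card (ground L) W) _ _ (begin
    card (ground L) Z + card (ground L) W  ≡⟨ card-∖-split (ground L) X Z zx ⟩
    card (ground L) X                      ≡⟨ sym ix ⟩
    r X                                    ≤⟨ rank-mono (⊆-∪∖ X Z) (∪-least Z W G zg wg) ⟩
    r (Z ∪ˢ W)                             ≤⟨ rank-subadd zg wg ⟩
    r Z + r W                              ≤⟨ +-monoʳ-≤ (r Z) (rank≤card wg) ⟩
    r Z + card (ground L) W                ∎))
    where
    open ≤-Reasoning
    W = X ∖ˢ Z
    zg = ⊆-trans Z X G zx xg
    wg = ⊆-trans W X G (X∖Y⊆X X Z) xg

  closure⇒rank≡ : ∀ {Y e} → T (closure L Y e) → r (Y ∪ˢ ｛ e ｝) ≡ r Y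
  closure⇒rank≡ {Y} {e} p = T-≡ᵇ⁻ (T-∧⁻ʳ {e ∈ᵇ ground L} p)

  rank≡⇒closure : ∀ {Y e} → T (G e) → r (Y ∪ˢ ｛ e ｝) ≡ r Y → T (closure L Y e)
  rank≡⇒closure g q = T-∧⁺ g (T-≡ᵇ⁺ q)

  rank-absorb-⊆ : ∀ {Y A B} → A ⊆ (Y ∪ˢ B) → Y ⊆ G → B ⊆ G → r (Y ∪ˢ B) ≡ r Y → r (Y ∪ˢ A) ≡ r Y
  rank-absorb-⊆ {Y} {A} {B} a⊆ yg bg e = ≤-antisym
    (≤-trans (rank-mono (∪-least Y A (Y ∪ˢ B) (X⊆X∪Y Y B) a⊆) (∪-least Y B G yg bg)) (≤-reflexive e))
    (rank-mono (X⊆X∪Y Y A) (∪-least Y A G yg (λ x p → ∪-least Y B G yg bg x (a⊆ x p))))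

  rank-absorb-∪ : ∀ {Y A B} → Y ⊆ G → A ⊆ G → B ⊆ G →
                  r (Y ∪ˢ A) ≡ r Y → r (Y ∪ˢ B) ≡ r Y → r (Y ∪ˢ (A ∪ˢ B)) ≡ r Y
  rank-absorb-∪ {Y} {A} {B} yg ag bg ea eb = begin
    r (Y ∪ˢ (A ∪ˢ B)) ≡⟨ r-ext _ _ (∪-least Y (A ∪ˢ B) G yg (∪-least A B G ag bg)) (λ x → sym (∨-assoc (Y x) (A x) (B x))) ⟩
    r ((Y ∪ˢ A) ∪ˢ B) ≡⟨ rank-absorb↑ (X⊆X∪Y Y A) (∪-least Y A G yg ag) bg eb ⟩
    r (Y ∪ˢ A)        ≡⟨ ea ⟩
    r Y               ∎
    where open ≡-Reasoning

  ⊆closure⇒rank≡ : ∀ {Y F} → Y ⊆ G → F ⊆ G → (∀ e → T (G e) → T (F e) → T (closure L Y e)) → r (Y ∪ˢ F) ≡ r Y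
  ⊆closure⇒rank≡ {Y} {F} yg fg c =
    rank-absorb-⊆ (λ x p → T-∨⁺ʳ (T-∧⁺ p (fg x p))) yg (λ x p → fg x (T-∧⁻ˡ p)) (upTo (ground L))
    where
    FG : List ℕ → Sub
    FG l = F ∩ˢ ⟦ l ⟧
    fgg : ∀ l → FG l ⊆ G
    fgg l x p = fg x (T-∧⁻ˡ p)
    Y∪∅ : r (Y ∪ˢ ∅ˢ) ≡ r Y
    Y∪∅ = r-ext _ Y (∪-least Y ∅ˢ G yg (λ _ ())) (λ z → ∨-identityʳ (Y z))
    at : ∀ x → r (Y ∪ˢ (F ∩ˢ ｛ x ｝)) ≡ r Y
    at x with T-dec (F x)
    ... | inj₁ fx = rank-absorb-⊆ (λ z p → T-∨⁺ʳ (T-∧⁻ʳ {F z} p)) yg (｛｝⊆ (fg x fx)) (closure⇒rank≡ (c x (fg x fx) fx))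
    ... | inj₂ nfx = rank-absorb-⊆ {B = ∅ˢ} absurd yg (λ _ ()) Y∪∅
      where
      absurd : (F ∩ˢ ｛ x ｝) ⊆ (Y ∪ˢ ∅ˢ)
      absurd z p = ⊥-elim (nfx (subst (λ w → T (F w)) (T-≡ᵇ⁻ (T-∧⁻ʳ {F z} p)) (T-∧⁻ˡ p)))
    upTo : ∀ l → r (Y ∪ˢ FG l) ≡ r Y
    upTo [] = rank-absorb-⊆ {B = ∅ˢ} (λ x p → ⊥-elim (T-∧⁻ʳ {F x} p)) yg (λ _ ()) Y∪∅
    upTo (x ∷ l) = begin
      r (Y ∪ˢ FG (x ∷ l))                      ≡⟨ r-ext _ _ (∪-least Y (FG (x ∷ l)) G yg (fgg (x ∷ l)))
                                                      (λ z → cong (Y z ∨_) (∧-distribˡ-∨ (F z) (z ≡ᵇ x) (z ∈ᵇ l))) ⟩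
      r (Y ∪ˢ ((F ∩ˢ ｛ x ｝) ∪ˢ FG l))         ≡⟨ rank-absorb-∪ yg (λ z p → fg z (T-∧⁻ˡ p)) (fgg l) (at x) (upTo l) ⟩
      r Y                                      ∎
      where open ≡-Reasoning

  rank≡⇒⊆closure : ∀ {Y F} → Y ⊆ G → F ⊆ G → r (Y ∪ˢ F) ≡ r Y → ∀ e → T (F e) → T (closure L Y e)
  rank≡⇒⊆closure {Y} {F} yg fg eq e fe = rank≡⇒closure (fg e fe) (≤-antisym
    (≤-trans (rank-mono (∪-least Y ｛ e ｝ (Y ∪ˢ F) (X⊆X∪Y Y F) (⊆-trans ｛ e ｝ F (Y ∪ˢ F) (｛｝⊆ fe) (Y⊆X∪Y Y F))) (∪-least Y F G yg fg))
             (≤-reflexive eq))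
    (rank-mono (X⊆X∪Y Y ｛ e ｝) (∪-least Y ｛ e ｝ G yg (｛｝⊆ (fg e fe)))))

  subsetᵇ-closure⇒rank≡ : ∀ {Y F} → Y ⊆ G → F ⊆ G → T (subsetᵇ (ground L) F (closure L Y)) → r (Y ∪ˢ F) ≡ r Y
  subsetᵇ-closure⇒rank≡ {Y} {F} yg fg p = ⊆closure⇒rank≡ yg fg (λ e g fe → subsetᵇ⁻ (ground L) F (closure L Y) p e g fe)

  rank≡⇒subsetᵇ-closure : ∀ {Y F} → Y ⊆ G → F ⊆ G → r (Y ∪ˢ F) ≡ r Y → T (subsetᵇ (ground L) F (closure L Y))
  rank≡⇒subsetᵇ-closure {Y} {F} yg fg eq = subsetᵇ⁺ (ground L) F (closure L Y) (λ e _ fe → rank≡⇒⊆closure yg fg eq e fe)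

-- Principal extensions

ind∧¬ : Bool → Bool → ℕ
ind∧¬ a b = if a ∧ not b then 1 else 0

ind∧¬≤1 : ∀ a b → ind∧¬ a b ≤ 1
ind∧¬≤1 false b = z≤n
ind∧¬≤1 true false = s≤s z≤n
ind∧¬≤1 true true = z≤n

ind∧¬-antitone : ∀ β β' → (T β → T β') → ind∧¬ true β' ≤ ind∧¬ true β
ind∧¬-antitone false β' _ = ind∧¬≤1 true β'
ind∧¬-antitone true true _ = z≤n
ind∧¬-antitone true false p = ⊥-elim (p tt)

-- The second alternative is where the extra unit fails to be submodular; it is paid for
-- by rank-∖q-submod-strict.
ind∧¬-submod : ∀ a b βA βB βU βI → (T βA → T βU) → (T βB → T βU) →
  (ind∧¬ (a ∨ b) βU + ind∧¬ (a ∧ b) βI ≤ ind∧¬ a βA + ind∧¬ b βB) ⊎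
  (T βA × T βB × ¬ T βI × (ind∧¬ (a ∨ b) βU + ind∧¬ (a ∧ b) βI ≤ suc (ind∧¬ a βA + ind∧¬ b βB)))
ind∧¬-submod false false _ _ _ _ _ _ = inj₁ z≤n
ind∧¬-submod true false βA _ βU _ pA _ = inj₁ (+-monoˡ-≤ 0 (ind∧¬-antitone βA βU pA))
ind∧¬-submod false true _ βB βU _ _ pB = inj₁ (subst (_≤ _) (sym (+-identityʳ _)) (ind∧¬-antitone βB βU pB))
ind∧¬-submod true true false false false βI _ _ = inj₁ (s≤s (ind∧¬≤1 true βI))
ind∧¬-submod true true true _ false _ pA _ = ⊥-elim (pA tt)
ind∧¬-submod true true _ true false _ _ pB = ⊥-elim (pB tt)
ind∧¬-submod true true _ _ true true _ _ = inj₁ z≤n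
ind∧¬-submod true true false _ true false _ _ = inj₁ (s≤s z≤n)
ind∧¬-submod true true true false true false _ _ = inj₁ (s≤s z≤n)
ind∧¬-submod true true true true true false _ _ = inj₂ (tt , tt , (λ ()) , s≤s z≤n)

ind∧¬-mono : ∀ a b βX βY → (T a → T b) → (T βX → T βY) →
  (ind∧¬ a βX ≤ ind∧¬ b βY) ⊎ (T a × T βY × ¬ T βX)
ind∧¬-mono false _ _ _ _ _ = inj₁ z≤n
ind∧¬-mono true false _ _ p _ = ⊥-elim (p tt)
ind∧¬-mono true true true true _ _ = inj₁ z≤n
ind∧¬-mono true true true false _ q = ⊥-elim (q tt)
ind∧¬-mono true true false false _ _ = inj₁ (s≤s z≤n)
ind∧¬-mono true true false true _ _ = inj₂ (tt , tt , (λ ()))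

module PrincipalExtension (L : RawMatroid) (m : IsMatroid L) (F : Sub) (q : ℕ)
                          (fg : F ⊆ ⟦ ground L ⟧) (q∉L : ¬ T (q ∈ᵇ ground L)) where
  open IsMatroid m
  open Rank L m

  L' : RawMatroid
  L' = principalExt L F q

  G' : Sub
  G' = ⟦ q ∷ ground L ⟧

  G⊆G' : G ⊆ G'
  G⊆G' x p = ∈ᵇ-there x q (ground L) p

  spans : Sub → Bool
  spans Y = subsetᵇ (ground L) F (closure L Y)

  _∖q : Sub → Sub
  Y ∖q = Y ∖ˢ ｛ q ｝

  ∖q⊆G : ∀ {Y} → Y ⊆ G' → (Y ∖q) ⊆ G
  ∖q⊆G {Y} yg x p with ∈ᵇ-∷⁻ x q (ground L) (yg x (T-∧⁻ˡ p))
  ... | inj₁ refl = ⊥-elim (T-not⁻ (T-∧⁻ʳ {Y x} p) (T-≡ᵇ-refl x))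
  ... | inj₂ h = h

  ∖q-mono : ∀ {X Y} → X ⊆ Y → (X ∖q) ⊆ (Y ∖q)
  ∖q-mono {X} f x p = T-∧⁺ (f x (T-∧⁻ˡ p)) (T-∧⁻ʳ {X x} p)

  ∖q-∩ : ∀ A B → ((A ∖q) ∩ˢ (B ∖q)) ≐ ((A ∩ˢ B) ∖q)
  ∖q-∩ A B x with A x | B x | x ≡ᵇ q
  ... | false | _ | _ = refl
  ... | true | _ | false = refl
  ... | true | true | true = refl
  ... | true | false | true = refl

  ∖q-∪ : ∀ A B → ((A ∖q) ∪ˢ (B ∖q)) ≐ ((A ∪ˢ B) ∖q)
  ∖q-∪ A B x = sym (∧-distribʳ-∨ (not (x ≡ᵇ q)) (A x) (B x))

  q∉ : ∀ {W} → W ⊆ G → ¬ T (W q)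
  q∉ wg p = q∉L (wg q p)

  [W∪q]∖q≐W : ∀ {W} → W ⊆ G → ((W ∪ˢ ｛ q ｝) ∖q) ≐ W
  [W∪q]∖q≐W {W} wg x with T-dec (x ≡ᵇ q)
  ... | inj₁ e rewrite T-≡ᵇ⁻ {x} {q} e | T⇒≡true (T-≡ᵇ-refl q) | ¬T⇒≡false (q∉ wg) = refl
  ... | inj₂ ne rewrite ¬T⇒≡false ne with W x
  ... | true = refl
  ... | false = refl

  spans⇒rank≡ : ∀ {Y} → Y ⊆ G → T (spans Y) → r (Y ∪ˢ F) ≡ r Y
  spans⇒rank≡ yg = subsetᵇ-closure⇒rank≡ yg fg

  rank≡⇒spans : ∀ {Y} → Y ⊆ G → r (Y ∪ˢ F) ≡ r Y → T (spans Y)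
  rank≡⇒spans yg = rank≡⇒subsetᵇ-closure yg fg

  spans-mono : ∀ {X Y} → X ⊆ Y → Y ⊆ G → T (spans X) → T (spans Y)
  spans-mono {X} {Y} xy yg p = rank≡⇒spans yg (rank-absorb↑ xy yg fg (spans⇒rank≡ (⊆-trans X Y G xy yg) p))

  spans-cong : ∀ {X Y} → X ⊆ G → X ≐ Y → spans X ≡ spans Y
  spans-cong {X} {Y} xg e = T-injective (spans-mono xy (⊆-trans Y X G yx xg)) (spans-mono yx xg)
    where
    xy : X ⊆ Y
    xy x p = subst T (e x) p
    yx : Y ⊆ X
    yx x p = subst T (sym (e x)) p

  rank-∖q-submod : ∀ A B → A ⊆ G' → B ⊆ G' →
                   r ((A ∪ˢ B) ∖q) + r ((A ∩ˢ B) ∖q) ≤ r (A ∖q) + r (B ∖q)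
  rank-∖q-submod A B ag bg = subst (_≤ r (A ∖q) + r (B ∖q))
    (cong₂ _+_ (r-ext _ _ (∪-least _ _ G (∖q⊆G ag) (∖q⊆G bg)) (∖q-∪ A B))
               (r-ext _ _ (λ x p → ∖q⊆G ag x (T-∧⁻ˡ p)) (∖q-∩ A B)))
    (rank-submod (∖q⊆G ag) (∖q⊆G bg))

  -- A modular pair (A∖q, B∖q) would, by rank-absorb∩, pass the spanning of F on to the intersection.
  rank-∖q-submod-strict : ∀ A B → A ⊆ G' → B ⊆ G' →
    T (spans (A ∖q)) → T (spans (B ∖q)) → ¬ T (spans ((A ∩ˢ B) ∖q)) →
    suc (r ((A ∪ˢ B) ∖q) + r ((A ∩ˢ B) ∖q)) ≤ r (A ∖q) + r (B ∖q)
  rank-∖q-submod-strict A B ag bg sa sb ¬sI = ≤∧≢⇒< (rank-∖q-submod A B ag bg) modular⇒spans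
    where
    A⁻ = A ∖q
    B⁻ = B ∖q
    a⁻g = ∖q⊆G ag
    b⁻g = ∖q⊆G bg
    I≐ = ∖q-∩ A B
    modular⇒spans : ¬ (r ((A ∪ˢ B) ∖q) + r ((A ∩ˢ B) ∖q) ≡ r A⁻ + r B⁻)
    modular⇒spans e = ¬sI (subst T (spans-cong (λ x p → a⁻g x (T-∧⁻ˡ p)) I≐) (rank≡⇒spans (λ x p → a⁻g x (T-∧⁻ˡ p))
      (rank-absorb∩ a⁻g b⁻g fg mod (spans⇒rank≡ a⁻g sa) (spans⇒rank≡ b⁻g sb))))
      where
      mod : r (A⁻ ∪ˢ B⁻) + r (A⁻ ∩ˢ B⁻) ≡ r A⁻ + r B⁻
      mod = trans (cong₂ _+_ (r-ext _ _ (∪-least _ _ G a⁻g b⁻g) (∖q-∪ A B))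
                             (r-ext _ _ (λ x p → a⁻g x (T-∧⁻ˡ p)) I≐)) e

  L'-r-ext : ∀ X Y → X ⊆ G' → X ≐ Y → rank L' X ≡ rank L' Y
  L'-r-ext X Y xg e = cong₂ _+_ (r-ext (X ∖q) (Y ∖q) (∖q⊆G xg) e∖q) (cong₂ ind∧¬ (e q) (spans-cong (∖q⊆G xg) e∖q))
    where
    e∖q : (X ∖q) ≐ (Y ∖q)
    e∖q x = cong₂ _∧_ (e x) refl

  L'-r-bound : ∀ X → X ⊆ G' → rank L' X ≤ card (q ∷ ground L) X
  L'-r-bound X xg = subst (rank L' X ≤_) (sym cq) (+-mono-≤ (≤-trans (rank≤card (∖q⊆G xg)) (≤-reflexive c2)) c1)
    where
    cq : card (q ∷ ground L) X ≡ card (ground L) X + card (q ∷ []) X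
    cq = trans (card-++ (q ∷ []) (ground L) X
                 (λ x m1 m2 → [ (λ e → q∉L (subst (λ z → T (z ∈ᵇ ground L)) e m2)) , (λ ()) ]′ (∈ᵇ-∷⁻ x q [] m1)))
               (+-comm (card (q ∷ []) X) (card (ground L) X))
    c2 : card (ground L) (X ∖q) ≡ card (ground L) X
    c2 = card-cong (ground L) (X ∖q) X (λ x _ p → T-∧⁻ˡ {X x} {not (x ≡ᵇ q)} p)
           (λ x mx p → T-∧⁺ {X x} {not (x ≡ᵇ q)} p (T-not⁺ {x ≡ᵇ q} (λ e → q∉L (subst (λ z → T (z ∈ᵇ ground L)) (T-≡ᵇ⁻ {x} {q} e) mx))))
    c1 : ind∧¬ (X q) (spans (X ∖q)) ≤ card (q ∷ []) X
    c1 with T-dec (X q)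
    ... | inj₂ nx = subst (λ z → ind∧¬ z (spans (X ∖q)) ≤ card (q ∷ []) X) (sym (¬T⇒≡false nx)) z≤n
    ... | inj₁ xq = ≤-trans (ind∧¬≤1 (X q) (spans (X ∖q)))
                      (≤-reflexive (sym (trans (card-cong (q ∷ []) X ｛ q ｝
                                (λ x mx _ → [ (λ e → T-≡ᵇ⁺ e) , (λ ()) ]′ (∈ᵇ-∷⁻ x q [] mx))
                                (λ x mx _ → [ (λ e → subst (λ z → T (X z)) (sym e) xq) , (λ ()) ]′ (∈ᵇ-∷⁻ x q [] mx)))
                              (card-｛｝ (q ∷ []) q (∈ᵇ-here q q [] refl)))))

  -- If Y∖q spans F but X∖q does not, then r (X∖q) < r (Y∖q) pays for the extra unit of X.
  L'-r-mono : ∀ X Y → X ⊆ Y → Y ⊆ G' → rank L' X ≤ rank L' Y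
  L'-r-mono X Y xy yg with ind∧¬-mono (X q) (Y q) (spans (X ∖q)) (spans (Y ∖q)) (xy q) (spans-mono (∖q-mono xy) (∖q⊆G yg))
  ... | inj₁ le = +-mono-≤ (rank-mono (∖q-mono xy) (∖q⊆G yg)) le
  ... | inj₂ (_ , sY , ¬sX) = begin
    r (X ∖q) + ind∧¬ (X q) (spans (X ∖q)) ≤⟨ +-monoʳ-≤ (r (X ∖q)) (ind∧¬≤1 (X q) (spans (X ∖q))) ⟩
    r (X ∖q) + 1                            ≡⟨ +-comm (r (X ∖q)) 1 ⟩
    suc (r (X ∖q))                          ≤⟨ ≤∧≢⇒< (rank-mono (∖q-mono xy) (∖q⊆G yg)) rank≢ ⟩
    r (Y ∖q)                                ≤⟨ m≤m+n _ _ ⟩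
    rank L' Y                               ∎
    where
    open ≤-Reasoning
    rank≢ : r (X ∖q) ≢ r (Y ∖q)
    rank≢ e = ¬sX (rank≡⇒spans (⊆-trans (X ∖q) (Y ∖q) G (∖q-mono xy) (∖q⊆G yg))
                    (rank-absorb↓ (∖q-mono xy) (∖q⊆G yg) fg e (spans⇒rank≡ (∖q⊆G yg) sY)))

  L'-rank-regroup : ∀ A B →
    (r ((A ∪ˢ B) ∖q) + r ((A ∩ˢ B) ∖q)) + (ind∧¬ (A q ∨ B q) (spans ((A ∪ˢ B) ∖q)) + ind∧¬ (A q ∧ B q) (spans ((A ∩ˢ B) ∖q)))
      ≤ (r (A ∖q) + r (B ∖q)) + (ind∧¬ (A q) (spans (A ∖q)) + ind∧¬ (B q) (spans (B ∖q))) →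
    rank L' (A ∪ˢ B) + rank L' (A ∩ˢ B) ≤ rank L' A + rank L' B
  L'-rank-regroup A B = subst₂ _≤_
    (sym (+-interchange (r ((A ∪ˢ B) ∖q)) (ind∧¬ (A q ∨ B q) (spans ((A ∪ˢ B) ∖q)))
                        (r ((A ∩ˢ B) ∖q)) (ind∧¬ (A q ∧ B q) (spans ((A ∩ˢ B) ∖q)))))
    (sym (+-interchange (r (A ∖q)) (ind∧¬ (A q) (spans (A ∖q))) (r (B ∖q)) (ind∧¬ (B q) (spans (B ∖q)))))

  L'-r-submod : ∀ A B → A ⊆ G' → B ⊆ G' → rank L' (A ∪ˢ B) + rank L' (A ∩ˢ B) ≤ rank L' A + rank L' B
  L'-r-submod A B ag bg
    with ind∧¬-submod (A q) (B q) (spans (A ∖q)) (spans (B ∖q)) (spans ((A ∪ˢ B) ∖q)) (spans ((A ∩ˢ B) ∖q))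
                      (spans-mono (∖q-mono (X⊆X∪Y A B)) (∖q⊆G (∪-least A B G' ag bg)))
                      (spans-mono (∖q-mono (Y⊆X∪Y A B)) (∖q⊆G (∪-least A B G' ag bg)))
  ... | inj₁ le = L'-rank-regroup A B (+-mono-≤ (rank-∖q-submod A B ag bg) le)
  ... | inj₂ (sA , sB , ¬sI , le) = L'-rank-regroup A B (≤-trans (+-monoʳ-≤ (r ((A ∪ˢ B) ∖q) + r ((A ∩ˢ B) ∖q)) le)
          (≤-trans (≤-reflexive (+-suc _ _)) (+-monoˡ-≤ _ (rank-∖q-submod-strict A B ag bg sA sB ¬sI))))

  isMatroid : IsMatroid L'
  isMatroid = record { r-ext = L'-r-ext ; r-bound = L'-r-bound ; r-mono = L'-r-mono ; r-submod = L'-r-submod }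

  rank-∪q : ∀ {W} → W ⊆ G → rank L' (W ∪ˢ ｛ q ｝) ≡ suc (r W) ⊓ r (W ∪ˢ F)
  rank-∪q {W} wg = begin
    rank L' Wq                                        ≡⟨ cong₂ _+_ (r-ext (Wq ∖q) W (∖q⊆G wqg) Wq∖q≐W) (cong₂ ind∧¬ q∈Wq (spans-cong (∖q⊆G wqg) Wq∖q≐W)) ⟩
    r W + ind∧¬ true (spans W)                        ≡⟨ by-spans (T-dec (spans W)) ⟩
    suc (r W) ⊓ r (W ∪ˢ F)                            ∎
    where
    open ≡-Reasoning
    Wq = W ∪ˢ ｛ q ｝
    wqg : Wq ⊆ G'
    wqg = ∪-least W ｛ q ｝ G' (⊆-trans W G G' wg G⊆G') (｛｝⊆ (∈ᵇ-here q q (ground L) refl))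
    Wq∖q≐W = [W∪q]∖q≐W wg
    q∈Wq : Wq q ≡ true
    q∈Wq = T⇒≡true (T-∨⁺ʳ {W q} (T-≡ᵇ-refl q))
    by-spans : T (spans W) ⊎ ¬ T (spans W) → r W + ind∧¬ true (spans W) ≡ suc (r W) ⊓ r (W ∪ˢ F)
    by-spans (inj₁ s) rewrite T⇒≡true s = trans (+-identityʳ (r W))
      (sym (trans (cong (suc (r W) ⊓_) (spans⇒rank≡ wg s)) (m≥n⇒m⊓n≡n (n≤1+n (r W)))))
    by-spans (inj₂ ¬s) rewrite ¬T⇒≡false ¬s = trans (+-comm (r W) 1) (sym (m≤n⇒m⊓n≡m
      (≤∧≢⇒< (rank-mono (X⊆X∪Y W F) (∪-least W F G wg fg)) (λ e → ¬s (rank≡⇒spans wg (sym e))))))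

-- Direct sums, relabelling, contraction and deletion

module DirectSum (A B : RawMatroid) (ma : IsMatroid A) (mb : IsMatroid B)
                 (disj : ∀ x → T (x ∈ᵇ ground A) → ¬ T (x ∈ᵇ ground B)) where
  D = directSum A B
  GA = ⟦ ground A ⟧
  GB = ⟦ ground B ⟧
  module MA = IsMatroid ma
  module MB = IsMatroid mb

  ∩-cong : ∀ (E : Sub) {X Y} → X ≐ Y → (X ∩ˢ E) ≐ (Y ∩ˢ E)
  ∩-cong E e x = cong₂ _∧_ (e x) refl

  ∩-mono : ∀ (E : Sub) {X Y} → X ⊆ Y → (X ∩ˢ E) ⊆ (Y ∩ˢ E)
  ∩-mono E {X} xy x p = T-∧⁺ (xy x (T-∧⁻ˡ p)) (T-∧⁻ʳ {X x} p)

  card-∩ : ∀ E X → card E (X ∩ˢ ⟦ E ⟧) ≡ card E X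
  card-∩ E X = card-cong E (X ∩ˢ ⟦ E ⟧) X (λ x _ p → T-∧⁻ˡ p) (λ x m p → T-∧⁺ p m)

  D-r-ext : ∀ X Y → X ⊆ ⟦ ground D ⟧ → X ≐ Y → rank D X ≡ rank D Y
  D-r-ext X Y _ e = cong₂ _+_ (MA.r-ext (X ∩ˢ GA) (Y ∩ˢ GA) (X∩Y⊆Y X GA) (∩-cong GA e))
                              (MB.r-ext (X ∩ˢ GB) (Y ∩ˢ GB) (X∩Y⊆Y X GB) (∩-cong GB e))

  D-r-bound : ∀ X → X ⊆ ⟦ ground D ⟧ → rank D X ≤ card (ground D) X
  D-r-bound X _ = subst (rank D X ≤_) (sym (card-++ (ground A) (ground B) X disj))
    (+-mono-≤ (≤-trans (MA.r-bound (X ∩ˢ GA) (X∩Y⊆Y X GA)) (≤-reflexive (card-∩ (ground A) X)))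
              (≤-trans (MB.r-bound (X ∩ˢ GB) (X∩Y⊆Y X GB)) (≤-reflexive (card-∩ (ground B) X))))

  D-r-mono : ∀ X Y → X ⊆ Y → Y ⊆ ⟦ ground D ⟧ → rank D X ≤ rank D Y
  D-r-mono X Y xy _ = +-mono-≤ (MA.r-mono (X ∩ˢ GA) (Y ∩ˢ GA) (∩-mono GA xy) (X∩Y⊆Y Y GA))
                               (MB.r-mono (X ∩ˢ GB) (Y ∩ˢ GB) (∩-mono GB xy) (X∩Y⊆Y Y GB))

  D-r-submod : ∀ X Y → X ⊆ ⟦ ground D ⟧ → Y ⊆ ⟦ ground D ⟧ → rank D (X ∪ˢ Y) + rank D (X ∩ˢ Y) ≤ rank D X + rank D Y
  D-r-submod X Y _ _ = subst₂ _≤_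
    (trans (+-interchange (rank A ((X ∩ˢ GA) ∪ˢ (Y ∩ˢ GA))) (rank A ((X ∩ˢ GA) ∩ˢ (Y ∩ˢ GA)))
                          (rank B ((X ∩ˢ GB) ∪ˢ (Y ∩ˢ GB))) (rank B ((X ∩ˢ GB) ∩ˢ (Y ∩ˢ GB))))
           (cong₂ _+_ (cong₂ _+_ (sym eAu) (sym eBu)) (cong₂ _+_ (sym eAi) (sym eBi))))
    (+-interchange (rank A (X ∩ˢ GA)) (rank A (Y ∩ˢ GA)) (rank B (X ∩ˢ GB)) (rank B (Y ∩ˢ GB)))
    (+-mono-≤ (MA.r-submod (X ∩ˢ GA) (Y ∩ˢ GA) (X∩Y⊆Y X GA) (X∩Y⊆Y Y GA))
              (MB.r-submod (X ∩ˢ GB) (Y ∩ˢ GB) (X∩Y⊆Y X GB) (X∩Y⊆Y Y GB)))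
    where
    eAu = MA.r-ext ((X ∪ˢ Y) ∩ˢ GA) _ (X∩Y⊆Y (X ∪ˢ Y) GA) (∩-distribʳ-∪ GA X Y)
    eBu = MB.r-ext ((X ∪ˢ Y) ∩ˢ GB) _ (X∩Y⊆Y (X ∪ˢ Y) GB) (∩-distribʳ-∪ GB X Y)
    eAi = MA.r-ext ((X ∩ˢ Y) ∩ˢ GA) _ (X∩Y⊆Y (X ∩ˢ Y) GA) (∩-distribʳ-∩ GA X Y)
    eBi = MB.r-ext ((X ∩ˢ Y) ∩ˢ GB) _ (X∩Y⊆Y (X ∩ˢ Y) GB) (∩-distribʳ-∩ GB X Y)

  isMatroid : IsMatroid D
  isMatroid = record { r-ext = D-r-ext ; r-bound = D-r-bound ; r-mono = D-r-mono ; r-submod = D-r-submod }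

module Relabel (N : RawMatroid) (μ : IsMatroid N) (φ : ℕ → ℕ) (inj : InjOn φ (ground N)) where
  N' = relabel N φ
  GN = ⟦ ground N ⟧
  module MN = IsMatroid μ

  preimage : Sub → Sub
  preimage Y x = (x ∈ᵇ ground N) ∧ Y (φ x)

  preimage⊆ : ∀ Y → preimage Y ⊆ GN
  preimage⊆ Y x p = T-∧⁻ˡ {GN x} {Y (φ x)} p

  preimage-∪ : ∀ X Y → (preimage X ∪ˢ preimage Y) ≐ preimage (X ∪ˢ Y)
  preimage-∪ X Y x = sym (∧-distribˡ-∨ (GN x) (X (φ x)) (Y (φ x)))

  preimage-∩ : ∀ X Y → (preimage X ∩ˢ preimage Y) ≐ preimage (X ∩ˢ Y)
  preimage-∩ X Y x with GN x
  ... | true = refl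
  ... | false = refl

  N'-r-ext : ∀ X Y → X ⊆ ⟦ ground N' ⟧ → X ≐ Y → rank N' X ≡ rank N' Y
  N'-r-ext X Y _ e = MN.r-ext (preimage X) (preimage Y) (preimage⊆ X) (λ x → cong (GN x ∧_) (e (φ x)))

  N'-r-bound : ∀ X → X ⊆ ⟦ ground N' ⟧ → rank N' X ≤ card (ground N') X
  N'-r-bound X _ = ≤-trans (MN.r-bound (preimage X) (preimage⊆ X))
    (≤-reflexive (trans (card-cong (ground N) (preimage X) (λ x → X (φ x)) (λ x _ p → T-∧⁻ʳ {GN x} {X (φ x)} p)
                                   (λ x m p → T-∧⁺ {GN x} {X (φ x)} m p))
                        (sym (card-map φ (ground N) X inj))))

  N'-r-mono : ∀ X Y → X ⊆ Y → Y ⊆ ⟦ ground N' ⟧ → rank N' X ≤ rank N' Y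
  N'-r-mono X Y xy _ = MN.r-mono (preimage X) (preimage Y)
    (λ x p → T-∧⁺ {GN x} {Y (φ x)} (preimage⊆ X x p) (xy (φ x) (T-∧⁻ʳ {GN x} {X (φ x)} p))) (preimage⊆ Y)

  N'-r-submod : ∀ X Y → X ⊆ ⟦ ground N' ⟧ → Y ⊆ ⟦ ground N' ⟧ →
                rank N' (X ∪ˢ Y) + rank N' (X ∩ˢ Y) ≤ rank N' X + rank N' Y
  N'-r-submod X Y _ _ = subst (_≤ rank N' X + rank N' Y)
    (cong₂ _+_ (MN.r-ext _ _ (∪-least (preimage X) (preimage Y) GN (preimage⊆ X) (preimage⊆ Y)) (preimage-∪ X Y))
               (MN.r-ext _ _ (λ x p → preimage⊆ X x (T-∧⁻ˡ p)) (preimage-∩ X Y)))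
    (MN.r-submod (preimage X) (preimage Y) (preimage⊆ X) (preimage⊆ Y))

  isMatroid : IsMatroid N'
  isMatroid = record { r-ext = N'-r-ext ; r-bound = N'-r-bound ; r-mono = N'-r-mono ; r-submod = N'-r-submod }

module Contraction (L : RawMatroid) (m : IsMatroid L) (C : Sub) (cg : C ⊆ ⟦ ground L ⟧) where
  open Rank L m
  L/ = contract L C
  G/ = ⟦ ground L/ ⟧

  G/⊆G : ∀ {Y} → Y ⊆ G/ → Y ⊆ G
  G/⊆G yg x p = ∈ᵇ-filterᵇ⁻ (λ x → not (C x)) x (ground L) (yg x p)

  ∪C⊆G : ∀ {Y} → Y ⊆ G/ → (Y ∪ˢ C) ⊆ G
  ∪C⊆G yg = ∪-least _ C G (G/⊆G yg) cg

  rank-C≤ : ∀ {Y} → Y ⊆ G/ → r C ≤ r (Y ∪ˢ C)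
  rank-C≤ {Y} yg = rank-mono (Y⊆X∪Y Y C) (∪C⊆G yg)

  L/-r-ext : ∀ X Y → X ⊆ G/ → X ≐ Y → rank L/ X ≡ rank L/ Y
  L/-r-ext X Y xg e = cong (_∸ r C) (IsMatroid.r-ext m (X ∪ˢ C) (Y ∪ˢ C) (∪C⊆G xg) (λ x → cong (_∨ C x) (e x)))

  L/-r-bound : ∀ X → X ⊆ G/ → rank L/ X ≤ card (ground L/) X
  L/-r-bound X xg = begin
    r (X ∪ˢ C) ∸ r C    ≤⟨ m≤n+o⇒m∸n≤o (r (X ∪ˢ C)) (r C) (≤-trans (rank-subadd (G/⊆G xg) cg) (≤-reflexive (+-comm (r X) (r C)))) ⟩
    r X                 ≤⟨ rank≤card (G/⊆G xg) ⟩
    card (ground L) X   ≡⟨ card-≡ (ground L) (ground L/) X X (λ x m p → xg x p , p) (λ x m p → G/⊆G xg x p , p) ⟩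
    card (ground L/) X  ∎
    where open ≤-Reasoning

  L/-r-mono : ∀ X Y → X ⊆ Y → Y ⊆ G/ → rank L/ X ≤ rank L/ Y
  L/-r-mono X Y xy yg = ∸-monoˡ-≤ (r C)
    (rank-mono (∪-least X C (Y ∪ˢ C) (⊆-trans X Y (Y ∪ˢ C) xy (X⊆X∪Y Y C)) (Y⊆X∪Y Y C)) (∪C⊆G yg))

  L/-r-submod : ∀ X Y → X ⊆ G/ → Y ⊆ G/ → rank L/ (X ∪ˢ Y) + rank L/ (X ∩ˢ Y) ≤ rank L/ X + rank L/ Y
  L/-r-submod X Y xg yg = ∸-sum-mono-≤ _ _ _ _ (r C)
    (rank-C≤ {X ∪ˢ Y} (∪-least X Y G/ xg yg)) (rank-C≤ {X ∩ˢ Y} (λ x p → xg x (T-∧⁻ˡ p))) (rank-C≤ xg) (rank-C≤ yg)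
    (subst (_≤ r (X ∪ˢ C) + r (Y ∪ˢ C))
           (cong₂ _+_ (sym (r-ext _ _ (∪C⊆G (∪-least X Y G/ xg yg)) (∪-distribʳ-∪ C X Y)))
                      (sym (r-ext _ _ (∪C⊆G {X ∩ˢ Y} (λ x p → xg x (T-∧⁻ˡ p))) (∪-distribʳ-∩ C X Y))))
           (rank-submod (∪C⊆G xg) (∪C⊆G yg)))
    where open IsMatroid m

  isMatroid : IsMatroid L/
  isMatroid = record { r-ext = L/-r-ext ; r-bound = L/-r-bound ; r-mono = L/-r-mono ; r-submod = L/-r-submod }

module Deletion (L : RawMatroid) (m : IsMatroid L) (D : Sub) where
  open Rank L m
  L\ = delete L D
  G\ = ⟦ ground L\ ⟧

  G\⊆G : ∀ {Y} → Y ⊆ G\ → Y ⊆ G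
  G\⊆G yg x p = ∈ᵇ-filterᵇ⁻ (λ x → not (D x)) x (ground L) (yg x p)

  isMatroid : IsMatroid L\
  isMatroid = record
    { r-ext = λ X Y xg → IsMatroid.r-ext m X Y (G\⊆G xg)
    ; r-bound = λ X xg → ≤-trans (rank≤card (G\⊆G xg))
        (≤-reflexive (card-≡ (ground L) (ground L\) X X (λ x _ p → xg x p , p) (λ x _ p → G\⊆G xg x p , p)))
    ; r-mono = λ X Y xy yg → IsMatroid.r-mono m X Y xy (G\⊆G yg)
    ; r-submod = λ X Y xg yg → IsMatroid.r-submod m X Y (G\⊆G xg) (G\⊆G yg)
    }

-- Iterated principal extensions

module IteratedMin (Fl : ℕ → Sub) where
  -- μ (rank L) ts Y is the rank of Y ∪ {q_t | t ∈ ts} after adding each q_t freely to Fl t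
  -- (fold-rank≡μ below); μ≤ and μ-attained give its closed form as a minimum over selections β.
  μ : (Sub → ℕ) → List ℕ → Sub → ℕ
  μ f [] Y = f Y
  μ f (t ∷ ts) Y = suc (μ f ts Y) ⊓ μ f ts (Y ∪ˢ Fl t)

  ⋃sel : List ℕ → (ℕ → Bool) → Sub
  ⋃sel ts β x = any (λ t → β t ∧ Fl t x) ts

  nunsel : List ℕ → (ℕ → Bool) → ℕ
  nunsel ts β = length (filterᵇ (λ t → not (β t)) ts)

  ⋃sel-off : ∀ t ts β → β t ≡ false → ⋃sel (t ∷ ts) β ≐ ⋃sel ts β
  ⋃sel-off t ts β e x rewrite e = refl

  nunsel-off : ∀ t ts β → β t ≡ false → nunsel (t ∷ ts) β ≡ suc (nunsel ts β)
  nunsel-off t ts β e rewrite e = refl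

  ⋃sel-on : ∀ t ts β → β t ≡ true → ⋃sel (t ∷ ts) β ≐ (Fl t ∪ˢ ⋃sel ts β)
  ⋃sel-on t ts β e x rewrite e = refl

  nunsel-on : ∀ t ts β → β t ≡ true → nunsel (t ∷ ts) β ≡ nunsel ts β
  nunsel-on t ts β e rewrite e = refl

  sel-agree : ∀ ts β β' → (∀ u → T (u ∈ᵇ ts) → β u ≡ β' u) → ⋃sel ts β ≐ ⋃sel ts β' × nunsel ts β ≡ nunsel ts β'
  sel-agree [] β β' h = (λ x → refl) , refl
  sel-agree (u ∷ us) β β' h with sel-agree us β β' (λ v m → h v (∈ᵇ-there v u us m))
  ... | eU , eN = (λ x → cong₂ _∨_ (cong (_∧ Fl u x) hu) (eU x)) , en
    where
    hu = h u (∈ᵇ-here u u us refl)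
    en : nunsel (u ∷ us) β ≡ nunsel (u ∷ us) β'
    en with β u | β' u | hu
    ... | true | .true | refl = eN
    ... | false | .false | refl = cong suc eN

  update : ℕ → Bool → (ℕ → Bool) → (ℕ → Bool)
  update t b β x = if x ≡ᵇ t then b else β x

  update-here : ∀ t b β → update t b β t ≡ b
  update-here t b β rewrite T⇒≡true (T-≡ᵇ-refl t) = refl

  update-there : ∀ t b β u → ¬ u ≡ t → update t b β u ≡ β u
  update-there t b β u n rewrite ¬T⇒≡false {u ≡ᵇ t} (λ e → n (T-≡ᵇ⁻ {u} {t} e)) = refl

  module OnGround (G : Sub) where
    Respects≐ : (Sub → ℕ) → Set
    Respects≐ f = ∀ X Y → X ⊆ G → X ≐ Y → f X ≡ f Y

    FlatsIn : List ℕ → Set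
    FlatsIn ts = ∀ t → T (t ∈ᵇ ts) → Fl t ⊆ G

    FlatsIn-tail : ∀ t ts → FlatsIn (t ∷ ts) → FlatsIn ts
    FlatsIn-tail t ts h u m = h u (∈ᵇ-there u t ts m)

    FlatsIn-head : ∀ t ts → FlatsIn (t ∷ ts) → Fl t ⊆ G
    FlatsIn-head t ts h = h t (∈ᵇ-here t t ts refl)

    μ-respects : ∀ f ts → Respects≐ f → FlatsIn ts → Respects≐ (μ f ts)
    μ-respects f [] rf xg = rf
    μ-respects f (t ∷ ts) rf xg X Y xG e =
      cong₂ (λ a b → suc a ⊓ b) (μ-respects f ts rf (FlatsIn-tail t ts xg) X Y xG e)
            (μ-respects f ts rf (FlatsIn-tail t ts xg) (X ∪ˢ Fl t) (Y ∪ˢ Fl t) (∪-least X (Fl t) G xG (FlatsIn-head t ts xg)) (∪-cong≐ (Fl t) e))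

    μ-cong : ∀ f g ts → (∀ W → W ⊆ G → f W ≡ g W) → FlatsIn ts → ∀ Y → Y ⊆ G → μ f ts Y ≡ μ g ts Y
    μ-cong f g [] h xg Y yg = h Y yg
    μ-cong f g (t ∷ ts) h xg Y yg =
      cong₂ (λ a b → suc a ⊓ b) (μ-cong f g ts h (FlatsIn-tail t ts xg) Y yg)
            (μ-cong f g ts h (FlatsIn-tail t ts xg) (Y ∪ˢ Fl t) (∪-least Y (Fl t) G yg (FlatsIn-head t ts xg)))

    μ-step-comm : ∀ f ts X → Respects≐ f → FlatsIn ts → X ⊆ G → ∀ Y → Y ⊆ G →
              μ (λ W → suc (f W) ⊓ f (W ∪ˢ X)) ts Y ≡ suc (μ f ts Y) ⊓ μ f ts (Y ∪ˢ X)
    μ-step-comm f [] X rf xg XG Y yg = refl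
    μ-step-comm f (u ∷ us) X rf xg XG Y yg =
      trans (cong₂ (λ a b → suc a ⊓ b) (μ-step-comm f us X rf xg' XG Y yg) (μ-step-comm f us X rf xg' XG (Y ∪ˢ Xu) yug))
            (trans (⊓-interchange (suc (suc a)) (suc b) (suc c) d)
                   (cong (λ z → (suc (suc a) ⊓ suc c) ⊓ (suc b ⊓ z)) (μ-respects f us rf xg' _ _ yug' (∪-swapʳ Y Xu X))))
      where
      xg' = FlatsIn-tail u us xg
      Xu = Fl u
      yug = ∪-least Y Xu G yg (FlatsIn-head u us xg)
      yug' = ∪-least (Y ∪ˢ Xu) X G yug XG
      a = μ f us Y
      b = μ f us (Y ∪ˢ X)
      c = μ f us (Y ∪ˢ Xu)
      d = μ f us ((Y ∪ˢ Xu) ∪ˢ X)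

    μ-∪｛｝ : ∀ f ts q → Respects≐ f → FlatsIn ts → ∀ Y → (Y ∪ˢ ｛ q ｝) ⊆ G →
               μ f ts (Y ∪ˢ ｛ q ｝) ≡ μ (λ W → f (W ∪ˢ ｛ q ｝)) ts Y
    μ-∪｛｝ f [] q rf xg Y yg = refl
    μ-∪｛｝ f (u ∷ us) q rf xg Y yg =
      cong₂ (λ a b → suc a ⊓ b) (μ-∪｛｝ f us q rf xg' Y yg)
            (trans (μ-respects f us rf xg' ((Y ∪ˢ ｛ q ｝) ∪ˢ Fl u) ((Y ∪ˢ Fl u) ∪ˢ ｛ q ｝)
                      (∪-least (Y ∪ˢ ｛ q ｝) (Fl u) G yg (FlatsIn-head u us xg)) (∪-swapʳ Y ｛ q ｝ (Fl u)))
                   (μ-∪｛｝ f us q rf xg' (Y ∪ˢ Fl u)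
                      (∪-least (Y ∪ˢ Fl u) ｛ q ｝ G (∪-least Y (Fl u) G (⊆-trans Y (Y ∪ˢ ｛ q ｝) G (X⊆X∪Y Y ｛ q ｝) yg) (FlatsIn-head u us xg))
                                                 (⊆-trans ｛ q ｝ (Y ∪ˢ ｛ q ｝) G (Y⊆X∪Y Y ｛ q ｝) yg))))
      where
      xg' = FlatsIn-tail u us xg

    ⋃sel⊆ : ∀ ts β → FlatsIn ts → ⋃sel ts β ⊆ G
    ⋃sel⊆ [] β xg x ()
    ⋃sel⊆ (t ∷ ts) β xg x p with T-∨⁻ {β t ∧ Fl t x} {⋃sel ts β x} p
    ... | inj₁ h = FlatsIn-head t ts xg x (T-∧⁻ʳ {β t} {Fl t x} h)
    ... | inj₂ h = ⋃sel⊆ ts β (FlatsIn-tail t ts xg) x h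

    μ≤ : ∀ f ts β → Respects≐ f → FlatsIn ts → ∀ Y → Y ⊆ G → μ f ts Y ≤ f (Y ∪ˢ ⋃sel ts β) + nunsel ts β
    μ≤ f [] β rf xg Y yg = ≤-reflexive (trans (rf Y (Y ∪ˢ ⋃sel [] β) yg (λ x → sym (∨-identityʳ (Y x)))) (sym (+-identityʳ _)))
    μ≤ f (t ∷ ts) β rf xg Y yg with β t in eq
    ... | true = ≤-trans (m⊓n≤n _ _) (≤-trans (μ≤ f ts β rf xg' (Y ∪ˢ Fl t) ytg)
                   (≤-reflexive (cong (_+ nunsel ts β) (rf _ _ (∪-least (Y ∪ˢ Fl t) (⋃sel ts β) G ytg (⋃sel⊆ ts β xg')) e))))
      where
      xg' = FlatsIn-tail t ts xg
      ytg = ∪-least Y (Fl t) G yg (FlatsIn-head t ts xg)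
      e : ((Y ∪ˢ Fl t) ∪ˢ ⋃sel ts β) ≐ (λ x → Y x ∨ (Fl t x ∨ ⋃sel ts β x))
      e x = ∨-assoc (Y x) (Fl t x) (⋃sel ts β x)
    ... | false = ≤-trans (m⊓n≤m _ _) (≤-trans (s≤s (μ≤ f ts β rf xg' Y yg))
                   (≤-reflexive (trans (sym (+-suc _ _)) (cong (λ z → z + suc (nunsel ts β)) (rf _ _ (∪-least Y (⋃sel ts β) G yg (⋃sel⊆ ts β xg')) (λ x → refl))))))
      where
      xg' = FlatsIn-tail t ts xg

    μ-attained : ∀ f ts → Distinct ts → Respects≐ f → FlatsIn ts → ∀ Y → Y ⊆ G →
               Σ (ℕ → Bool) λ β → μ f ts Y ≡ f (Y ∪ˢ ⋃sel ts β) + nunsel ts β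
    μ-attained f [] u rf xg Y yg = (λ _ → false) , trans (rf Y _ yg (λ x → sym (∨-identityʳ (Y x)))) (sym (+-identityʳ _))
    μ-attained f (t ∷ ts) (nt , u) rf xg Y yg with ⊓-sel (suc (μ f ts Y)) (μ f ts (Y ∪ˢ Fl t))
    ... | inj₁ e with μ-attained f ts u rf (FlatsIn-tail t ts xg) Y yg
    ... | β' , e' = β , trans e (trans (cong suc e') (trans (sym (+-suc _ _))
                        (cong₂ _+_ (rf _ _ (∪-least Y (⋃sel ts β') G yg (⋃sel⊆ ts β' xg')) eU) (sym (trans (nunsel-off t ts β (update-here t false β')) (cong suc eN))))))
      where
      xg' = FlatsIn-tail t ts xg
      β = update t false β'
      ag = sel-agree ts β β' (λ v m → update-there t false β' v (λ { refl → nt m }))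
      eN = proj₂ ag
      eU : (Y ∪ˢ ⋃sel ts β') ≐ (Y ∪ˢ ⋃sel (t ∷ ts) β)
      eU x = cong (Y x ∨_) (sym (trans (⋃sel-off t ts β (update-here t false β') x) (proj₁ ag x)))
    μ-attained f (t ∷ ts) (nt , u) rf xg Y yg | inj₂ e with μ-attained f ts u rf (FlatsIn-tail t ts xg) (Y ∪ˢ Fl t) (∪-least Y (Fl t) G yg (FlatsIn-head t ts xg))
    ... | β' , e' = β , trans e (trans e'
                        (cong₂ _+_ (rf _ _ (∪-least (Y ∪ˢ Fl t) (⋃sel ts β') G ytg (⋃sel⊆ ts β' xg')) eU) (sym (trans (nunsel-on t ts β (update-here t true β')) eN))))
      where
      xg' = FlatsIn-tail t ts xg
      ytg = ∪-least Y (Fl t) G yg (FlatsIn-head t ts xg)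
      β = update t true β'
      ag = sel-agree ts β β' (λ v m → update-there t true β' v (λ { refl → nt m }))
      eN = proj₂ ag
      eU : ((Y ∪ˢ Fl t) ∪ˢ ⋃sel ts β') ≐ (Y ∪ˢ ⋃sel (t ∷ ts) β)
      eU x rewrite ⋃sel-on t ts β (update-here t true β') x | proj₁ ag x with Y x | Fl t x
      ... | true | b = refl
      ... | false | true = refl
      ... | false | false = refl

-- The bonding

module Bonding (M N : RawMatroid) (mM : IsMatroid M) (mN : IsMatroid N)
            (iM : Indep M (Tset M N)) (iN : Indep N (Tset M N))
            (σ κ : ℕ → ℕ) (fr : FreshLabels M N σ κ) where
  open FreshLabels fr

  GM = ⟦ ground M ⟧
  GN = ⟦ ground N ⟧
  Tl = Tlist M N

  Tl⇒M×N : ∀ x → T (x ∈ᵇ Tl) → T (GM x) × T (GN x)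
  Tl⇒M×N x m = ∈ᵇ-filterᵇ⁻ GN x (ground M) m' , ∈ᵇ-filterᵇ⇒p GN x (ground M) m'
    where m' = ∈ᵇ-dedup⁻ x (filterᵇ GN (ground M)) m

  M×N⇒Tl : ∀ x → T (GM x) → T (GN x) → T (x ∈ᵇ Tl)
  M×N⇒Tl x a b = ∈ᵇ-dedup⁺ x (filterᵇ GN (ground M)) (∈ᵇ-filterᵇ⁺ GN x (ground M) a b)

  Tl⇒Tset : ∀ x → T (x ∈ᵇ Tl) → T (Tset M N x)
  Tl⇒Tset x m = T-∧⁺ {GM x} {GN x} (proj₁ (Tl⇒M×N x m)) (proj₂ (Tl⇒M×N x m))

  Tl-distinct : Distinct Tl
  Tl-distinct = Distinct-dedup (filterᵇ GN (ground M))

  σM : ∀ t → T (t ∈ᵇ Tl) → ¬ T (GM (σ t))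
  σM t m = proj₁ (σ-fresh t (Tl⇒Tset t m))
  σN : ∀ t → T (t ∈ᵇ Tl) → ¬ T (GN (σ t))
  σN t m = proj₂ (σ-fresh t (Tl⇒Tset t m))
  κM : ∀ t → T (t ∈ᵇ Tl) → ¬ T (GM (κ t))
  κM t m = proj₁ (κ-fresh t (Tl⇒Tset t m))
  κN : ∀ t → T (t ∈ᵇ Tl) → ¬ T (GN (κ t))
  κN t m = proj₂ (κ-fresh t (Tl⇒Tset t m))
  σinj : ∀ t t' → T (t ∈ᵇ Tl) → T (t' ∈ᵇ Tl) → σ t ≡ σ t' → t ≡ t'
  σinj t t' m m' = σ-inj t t' (Tl⇒Tset t m) (Tl⇒Tset t' m')
  κinj : ∀ t t' → T (t ∈ᵇ Tl) → T (t' ∈ᵇ Tl) → κ t ≡ κ t' → t ≡ t'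
  κinj t t' m m' = κ-inj t t' (Tl⇒Tset t m) (Tl⇒Tset t' m')
  σκ : ∀ t t' → T (t ∈ᵇ Tl) → T (t' ∈ᵇ Tl) → σ t ≢ κ t'
  σκ t t' m m' = σκ-disj t t' (Tl⇒Tset t m) (Tl⇒Tset t' m')

  φ : ℕ → ℕ
  φ x = if x ∈ᵇ Tl then σ x else x

  φ-on-T : ∀ x → T (x ∈ᵇ Tl) → φ x ≡ σ x
  φ-on-T x m rewrite T⇒≡true m = refl

  φ-off-T : ∀ x → ¬ T (x ∈ᵇ Tl) → φ x ≡ x
  φ-off-T x m rewrite ¬T⇒≡false m = refl

  φ-inj : InjOn φ (ground N)
  φ-inj x x' mx mx' e with T-dec (x ∈ᵇ Tl) | T-dec (x' ∈ᵇ Tl)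
  ... | inj₁ a | inj₁ b = σinj x x' a b (trans (sym (φ-on-T x a)) (trans e (φ-on-T x' b)))
  ... | inj₁ a | inj₂ b = ⊥-elim (σN x a (subst (λ z → T (GN z)) (sym (trans (sym (φ-on-T x a)) (trans e (φ-off-T x' b)))) mx'))
  ... | inj₂ a | inj₁ b = ⊥-elim (σN x' b (subst (λ z → T (GN z)) (trans (sym (φ-off-T x a)) (trans e (φ-on-T x' b))) mx))
  ... | inj₂ a | inj₂ b = trans (sym (φ-off-T x a)) (trans e (φ-off-T x' b))

  N' = relabel N φ
  mN' : IsMatroid N'
  mN' = Relabel.isMatroid N mN φ φ-inj

  ∈N'⁻ : ∀ z → T (z ∈ᵇ map φ (ground N)) → (Σ ℕ λ t → T (t ∈ᵇ Tl) × z ≡ σ t) ⊎ (T (GN z) × ¬ T (z ∈ᵇ Tl))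
  ∈N'⁻ z m with ∈ᵇ-map⁻ z φ (ground N) m
  ... | y , my , e with T-dec (y ∈ᵇ Tl)
  ... | inj₁ a = inj₁ (y , a , trans e (φ-on-T y a))
  ... | inj₂ a = inj₂ (subst (λ w → T (GN w)) (sym (trans e (φ-off-T y a))) my , subst (λ w → ¬ T (w ∈ᵇ Tl)) (sym (trans e (φ-off-T y a))) a)

  M-N'-disjoint : ∀ x → T (GM x) → T (x ∈ᵇ map φ (ground N)) → ⊥
  M-N'-disjoint x a b with ∈N'⁻ x b
  ... | inj₁ (t , m , refl) = σM t m a
  ... | inj₂ (c , d) = d (M×N⇒Tl x a c)

  D = directSum M N'
  mD : IsMatroid D
  mD = DirectSum.isMatroid M N' mM mN' M-N'-disjoint
  GD = ⟦ ground D ⟧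

  clPair : ℕ → Sub
  clPair t = closure D (｛ t ｝ ∪ˢ ｛ σ t ｝)

  clPair⊆ : ∀ t → clPair t ⊆ GD
  clPair⊆ t x p = T-∧⁻ˡ {GD x} p

  step : RawMatroid → ℕ → RawMatroid
  step L t = principalExt L (clPair t) (κ t)

  H = foldl step D Tl

  Q : Sub
  Q x = any (λ t → κ t ≡ᵇ x) Tl
  S : Sub
  S x = any (λ t → σ t ≡ᵇ x) Tl

  K = bonding M N σ κ

  record FoldInv (L : RawMatroid) (ts : List ℕ) : Set where
    field
      mat : IsMatroid L
      sup : GD ⊆ ⟦ ground L ⟧
      fresh : ∀ t → T (t ∈ᵇ ts) → ¬ T (κ t ∈ᵇ ground L)

  FoldInv-step : ∀ L t ts → ⟦ t ∷ ts ⟧ ⊆ ⟦ Tl ⟧ → Distinct (t ∷ ts) → FoldInv L (t ∷ ts) → FoldInv (step L t) ts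
  FoldInv-step L t ts sub (nt , u) inv = record { mat = mat' ; sup = sup' ; fresh = fresh' }
    where
    open FoldInv inv
    mat' : IsMatroid (step L t)
    mat' = PrincipalExtension.isMatroid L mat (clPair t) (κ t) (⊆-trans (clPair t) GD ⟦ ground L ⟧ (clPair⊆ t) sup) (fresh t (∈ᵇ-here t t ts refl))
    sup' : GD ⊆ ⟦ ground (step L t) ⟧
    sup' x p = ∈ᵇ-there x (κ t) (ground L) (sup x p)
    fresh' : ∀ t' → T (t' ∈ᵇ ts) → ¬ T (κ t' ∈ᵇ ground (step L t))
    fresh' t' m' h with ∈ᵇ-∷⁻ (κ t') (κ t) (ground L) h
    ... | inj₁ e = nt (subst (λ z → T (z ∈ᵇ ts)) (κinj t' t (sub t' (∈ᵇ-there t' t ts m')) (sub t (∈ᵇ-here t t ts refl)) e) m')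
    ... | inj₂ h' = fresh t' (∈ᵇ-there t' t ts m') h'

  FoldInv-D : FoldInv D Tl
  FoldInv-D = record { mat = mD ; sup = λ x p → p ; fresh = fr' }
    where
    fr' : ∀ t → T (t ∈ᵇ Tl) → ¬ T (κ t ∈ᵇ ground D)
    fr' t m h with ∈ᵇ-++⁻ (κ t) (ground M) (map φ (ground N)) h
    ... | inj₁ a = κM t m a
    ... | inj₂ b with ∈N'⁻ (κ t) b
    ... | inj₁ (t' , m' , e) = σκ t' t m' m (sym e)
    ... | inj₂ (c , _) = κN t m c

  fold-isMatroid : ∀ ts L → ⟦ ts ⟧ ⊆ ⟦ Tl ⟧ → Distinct ts → FoldInv L ts → IsMatroid (foldl step L ts)
  fold-isMatroid [] L sub u inv = FoldInv.mat inv
  fold-isMatroid (t ∷ ts) L sub u inv = fold-isMatroid ts (step L t) (λ v m → sub v (∈ᵇ-there v t ts m)) (proj₂ u) (FoldInv-step L t ts sub u inv)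

  fold-ground⁺ : ∀ ts L x → T (x ∈ᵇ ground L) → T (x ∈ᵇ ground (foldl step L ts))
  fold-ground⁺ [] L x p = p
  fold-ground⁺ (t ∷ ts) L x p = fold-ground⁺ ts (step L t) x (∈ᵇ-there x (κ t) (ground L) p)

  fold-groundκ : ∀ ts L t → T (t ∈ᵇ ts) → T (κ t ∈ᵇ ground (foldl step L ts))
  fold-groundκ [] L t ()
  fold-groundκ (u ∷ ts) L t m with ∈ᵇ-∷⁻ t u ts m
  ... | inj₁ refl = fold-ground⁺ ts (step L t) (κ t) (∈ᵇ-here (κ t) (κ t) (ground L) refl)
  ... | inj₂ h = fold-groundκ ts (step L u) t h

  fold-ground⁻ : ∀ ts L x → T (x ∈ᵇ ground (foldl step L ts)) → T (x ∈ᵇ ground L) ⊎ (Σ ℕ λ t → T (t ∈ᵇ ts) × x ≡ κ t)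
  fold-ground⁻ [] L x p = inj₁ p
  fold-ground⁻ (t ∷ ts) L x p with fold-ground⁻ ts (step L t) x p
  ... | inj₂ (u , m , e) = inj₂ (u , ∈ᵇ-there u t ts m , e)
  ... | inj₁ h with ∈ᵇ-∷⁻ x (κ t) (ground L) h
  ... | inj₁ e = inj₂ (t , ∈ᵇ-here t t ts refl , e)
  ... | inj₂ h' = inj₁ h'

  mH : IsMatroid H
  mH = fold-isMatroid Tl D (λ u m → m) Tl-distinct FoldInv-D

  GH = ⟦ ground H ⟧

  Q⊆ : Q ⊆ GH
  Q⊆ x p with any≡⁻ κ Tl x p
  ... | t , m , refl = fold-groundκ Tl D t m

  mC : IsMatroid (contract H Q)
  mC = Contraction.isMatroid H mH Q Q⊆

  mK : IsMatroid K
  mK = Deletion.isMatroid (contract H Q) mC S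

  Qof : List ℕ → Sub
  Qof ts x = any (λ t → κ t ≡ᵇ x) ts

  module IM = IteratedMin clPair

  Qof-∷ : ∀ Y t ts → (Y ∪ˢ Qof (t ∷ ts)) ≐ ((Y ∪ˢ ｛ κ t ｝) ∪ˢ Qof ts)
  Qof-∷ Y t ts x rewrite ≡ᵇ-comm (κ t) x with Y x | x ≡ᵇ κ t
  ... | true | b = refl
  ... | false | true = refl
  ... | false | false = refl

  fold-rank≡μ : ∀ ts L → ⟦ ts ⟧ ⊆ ⟦ Tl ⟧ → Distinct ts → (inv : FoldInv L ts) →
              ∀ Y → Y ⊆ ⟦ ground L ⟧ → rank (foldl step L ts) (Y ∪ˢ Qof ts) ≡ IM.μ (rank L) ts Y
  fold-rank≡μ [] L sub u inv Y yg = IsMatroid.r-ext (FoldInv.mat inv) (Y ∪ˢ Qof []) Y (∪-least Y (Qof []) _ yg (λ x ())) (λ x → ∨-identityʳ (Y x))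
  fold-rank≡μ (t ∷ ts) L sub (nt , u) inv Y yg = begin
      rank F (Y ∪ˢ Qof (t ∷ ts)) ≡⟨ IsMatroid.r-ext mF _ _ s1 (Qof-∷ Y t ts) ⟩
      rank F (Y₁ ∪ˢ Qof ts) ≡⟨ fold-rank≡μ ts L₁ sub' u inv₁ Y₁ y₁g ⟩
      IM.μ (rank L₁) ts Y₁ ≡⟨ IM.OnGround.μ-∪｛｝ G₁ (rank L₁) ts (κ t) (IsMatroid.r-ext mL₁) xg₁ Y y₁g ⟩
      IM.μ (λ W → rank L₁ (W ∪ˢ ｛ κ t ｝)) ts Y ≡⟨ IM.OnGround.μ-cong G _ _ ts (λ W wg → PEt.rank-∪q wg) xg Y yg ⟩
      IM.μ (λ W → suc (rank L W) ⊓ rank L (W ∪ˢ clPair t)) ts Y ≡⟨ IM.OnGround.μ-step-comm G (rank L) ts (clPair t) (IsMatroid.r-ext mL) xg (xcg t) Y yg ⟩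
      IM.μ (rank L) (t ∷ ts) Y ∎
    where
    open ≡-Reasoning
    mL = FoldInv.mat inv
    G = ⟦ ground L ⟧
    L₁ = step L t
    G₁ = ⟦ ground L₁ ⟧
    F = foldl step L₁ ts
    sub' : ⟦ ts ⟧ ⊆ ⟦ Tl ⟧
    sub' v m = sub v (∈ᵇ-there v t ts m)
    inv₁ = FoldInv-step L t ts sub (nt , u) inv
    mL₁ = FoldInv.mat inv₁
    mF = fold-isMatroid ts L₁ sub' u inv₁
    module PEt = PrincipalExtension L mL (clPair t) (κ t) (⊆-trans (clPair t) GD G (clPair⊆ t) (FoldInv.sup inv)) (FoldInv.fresh inv t (∈ᵇ-here t t ts refl))
    xcg : ∀ v → clPair v ⊆ G
    xcg v = ⊆-trans (clPair v) GD G (clPair⊆ v) (FoldInv.sup inv)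
    xg : IM.OnGround.FlatsIn G ts
    xg v _ = xcg v
    xg₁ : IM.OnGround.FlatsIn G₁ ts
    xg₁ v _ = ⊆-trans (clPair v) GD G₁ (clPair⊆ v) (FoldInv.sup inv₁)
    Y₁ = Y ∪ˢ ｛ κ t ｝
    y₁g : Y₁ ⊆ G₁
    y₁g = ∪-least Y ｛ κ t ｝ G₁ (λ x p → ∈ᵇ-there x (κ t) (ground L) (yg x p)) (｛｝⊆ (∈ᵇ-here (κ t) (κ t) (ground L) refl))
    s1 : (Y ∪ˢ Qof (t ∷ ts)) ⊆ ⟦ ground F ⟧
    s1 = ∪-least Y (Qof (t ∷ ts)) _ (λ x p → fold-ground⁺ ts L₁ x (∈ᵇ-there x (κ t) (ground L) (yg x p)))
            (λ x p → case any≡⁻ κ (t ∷ ts) x p of λ { (v , m , refl) → fold-groundκ (t ∷ ts) L v m })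

  rD = rank D

  rankH≡μ : ∀ Y → Y ⊆ GD → rank H (Y ∪ˢ Q) ≡ IM.μ rD Tl Y
  rankH≡μ Y yg = fold-rank≡μ Tl D (λ u m → m) Tl-distinct FoldInv-D Y yg

  E : Sub
  E = ⟦ ground M ++ ground N ⟧

  E⁻ : ∀ x → T (E x) → T (GM x) ⊎ T (GN x)
  E⁻ x p = ∈ᵇ-++⁻ x (ground M) (ground N) p

  σ∉ : ∀ {Y} → Y ⊆ E → ∀ t → T (t ∈ᵇ Tl) → ¬ T (Y (σ t))
  σ∉ yg t m p with E⁻ (σ t) (yg (σ t) p)
  ... | inj₁ a = σM t m a
  ... | inj₂ b = σN t m b

  GN⇒GD : ∀ x → T (GN x) → T (GD x)
  GN⇒GD x p with T-dec (x ∈ᵇ Tl)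
  ... | inj₁ a = ∈ᵇ-++⁺ˡ x (ground M) (map φ (ground N)) (proj₁ (Tl⇒M×N x a))
  ... | inj₂ b = ∈ᵇ-++⁺ʳ x (ground M) (map φ (ground N)) (subst (λ z → T (z ∈ᵇ map φ (ground N))) (φ-off-T x b) (∈ᵇ-map⁺ x φ (ground N) p))

  E⊆GD : E ⊆ GD
  E⊆GD x p with E⁻ x p
  ... | inj₁ a = ∈ᵇ-++⁺ˡ x (ground M) (map φ (ground N)) a
  ... | inj₂ b = GN⇒GD x b

  σGD : ∀ t → T (t ∈ᵇ Tl) → T (GD (σ t))
  σGD t m = ∈ᵇ-++⁺ʳ (σ t) (ground M) (map φ (ground N))
              (subst (λ z → T (z ∈ᵇ map φ (ground N))) (φ-on-T t m) (∈ᵇ-map⁺ t φ (ground N) (proj₂ (Tl⇒M×N t m))))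

  pair : ℕ → Sub
  pair t = ｛ t ｝ ∪ˢ ｛ σ t ｝

  pair⊆ : ∀ t → T (t ∈ᵇ Tl) → pair t ⊆ GD
  pair⊆ t m = ∪-least ｛ t ｝ ｛ σ t ｝ GD (｛｝⊆ (∈ᵇ-++⁺ˡ t (ground M) (map φ (ground N)) (proj₁ (Tl⇒M×N t m)))) (｛｝⊆ (σGD t m))

  Tsel : (ℕ → Bool) → Sub
  Tsel β x = (x ∈ᵇ Tl) ∧ β x

  pairs : (ℕ → Bool) → Sub
  pairs β x = any (λ t → β t ∧ pair t x) Tl

  module MD = Rank D mD
  module IMD = IM.OnGround GD

  pairs⊆ : ∀ β → pairs β ⊆ GD
  pairs⊆ β x p with any⁻ (λ t → β t ∧ pair t x) Tl p
  ... | t , m , h = pair⊆ t m x (T-∧⁻ʳ {β t} {pair t x} h)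

  pair⊆clPair : ∀ t → T (t ∈ᵇ Tl) → pair t ⊆ clPair t
  pair⊆clPair t m x p = MD.rank≡⇒closure (pair⊆ t m x p) (MD.rank-cong (∪-least (pair t) ｛ x ｝ GD (pair⊆ t m) (｛｝⊆ (pair⊆ t m x p)))
                                             (∪-least (pair t) ｛ x ｝ (pair t) (⊆-refl (pair t)) (｛｝⊆ p)) (X⊆X∪Y (pair t) ｛ x ｝))

  pairs⊆⋃sel : ∀ β → pairs β ⊆ IM.⋃sel Tl β
  pairs⊆⋃sel β x p with any⁻ (λ t → β t ∧ pair t x) Tl p
  ... | t , m , h = any⁺ (λ t → β t ∧ clPair t x) Tl t m (T-∧⁺ {β t} {clPair t x} (T-∧⁻ˡ {β t} {pair t x} h) (pair⊆clPair t m x (T-∧⁻ʳ {β t} {pair t x} h)))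

  clPairs-in-D : IMD.FlatsIn Tl
  clPairs-in-D t _ = clPair⊆ t

  -- Once the pair {t, σ t} is present, its closure adds nothing to the rank.
  rankD-⋃sel≡rankD-pairs : ∀ Y β → Y ⊆ GD → rD (Y ∪ˢ IM.⋃sel Tl β) ≡ rD (Y ∪ˢ pairs β)
  rankD-⋃sel≡rankD-pairs Y β yg = trans (MD.rank-cong (∪-least Y U GD yg ug) s1 s2) (MD.⊆closure⇒rank≡ y'g ug cl)
    where
    U = IM.⋃sel Tl β
    ug = IMD.⋃sel⊆ Tl β clPairs-in-D
    Y' = Y ∪ˢ pairs β
    y'g = ∪-least Y (pairs β) GD yg (pairs⊆ β)
    s1 : (Y ∪ˢ U) ⊆ (Y' ∪ˢ U)
    s1 = ∪-least Y U (Y' ∪ˢ U) (⊆-trans Y Y' (Y' ∪ˢ U) (X⊆X∪Y Y (pairs β)) (X⊆X∪Y Y' U)) (Y⊆X∪Y Y' U)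
    s2 : (Y' ∪ˢ U) ⊆ (Y ∪ˢ U)
    s2 = ∪-least Y' U (Y ∪ˢ U) (∪-least Y (pairs β) (Y ∪ˢ U) (X⊆X∪Y Y U) (⊆-trans (pairs β) U (Y ∪ˢ U) (pairs⊆⋃sel β) (Y⊆X∪Y Y U))) (Y⊆X∪Y Y U)
    cl : ∀ e → T (GD e) → T (U e) → T (closure D Y' e)
    cl e ge ue with any⁻ (λ t → β t ∧ clPair t e) Tl ue
    ... | t , m , h = MD.rank≡⇒closure ge (MD.rank-absorb↑ {pair t} {Y'} {｛ e ｝} ptY' y'g (｛｝⊆ ge) (MD.closure⇒rank≡ {pair t} {e} (T-∧⁻ʳ {β t} {clPair t e} h)))
      where
      ptY' : pair t ⊆ Y'
      ptY' x p = T-∨⁺ʳ {Y x} {pairs β x} (any⁺ (λ t → β t ∧ pair t x) Tl t m (T-∧⁺ {β t} {pair t x} (T-∧⁻ˡ {β t} {clPair t e} h) p))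

  GN' : Sub
  GN' = ⟦ map φ (ground N) ⟧

  -- The part of Y in E(N) ∖ T, which is not renamed in N'.
  offT : Sub → Sub
  offT Y x = GN x ∧ (not (x ∈ᵇ Tl) ∧ Y x)

  pairs⁺ : ∀ β t → T (t ∈ᵇ Tl) → T (β t) → ∀ x → T (pair t x) → T (pairs β x)
  pairs⁺ β t m b x p = any⁺ (λ t → β t ∧ pair t x) Tl t m (T-∧⁺ {β t} {pair t x} b p)

  pairs⁻ : ∀ β x → T (pairs β x) → Σ ℕ λ t → T (t ∈ᵇ Tl) × T (β t) × (x ≡ t ⊎ x ≡ σ t)
  pairs⁻ β x p with any⁻ (λ t → β t ∧ pair t x) Tl p
  ... | t , m , h = t , m , T-∧⁻ˡ {β t} {pair t x} h ,
        [ (λ q → inj₁ (T-≡ᵇ⁻ {x} {t} q)) , (λ q → inj₂ (T-≡ᵇ⁻ {x} {σ t} q)) ]′ (T-∨⁻ {x ≡ᵇ t} {x ≡ᵇ σ t} (T-∧⁻ʳ {β t} {pair t x} h))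

  pairs-∩M : ∀ Y β → Y ⊆ E → ((Y ∪ˢ pairs β) ∩ˢ GM) ≐ ((Y ∩ˢ GM) ∪ˢ Tsel β)
  pairs-∩M Y β yg x = T-injective f g
    where
    f : T ((Y ∪ˢ pairs β) x ∧ GM x) → T ((Y x ∧ GM x) ∨ Tsel β x)
    f p with T-∨⁻ {Y x} {pairs β x} (T-∧⁻ˡ {(Y ∪ˢ pairs β) x} {GM x} p)
    ... | inj₁ y = T-∨⁺ˡ {Y x ∧ GM x} {Tsel β x} (T-∧⁺ {Y x} {GM x} y (T-∧⁻ʳ {(Y ∪ˢ pairs β) x} {GM x} p))
    ... | inj₂ q with pairs⁻ β x q
    ... | t , m , b , inj₁ refl = T-∨⁺ʳ {Y x ∧ GM x} {Tsel β x} (T-∧⁺ {x ∈ᵇ Tl} {β x} m b)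
    ... | t , m , b , inj₂ refl = ⊥-elim (σM t m (T-∧⁻ʳ {(Y ∪ˢ pairs β) x} {GM x} p))
    g : T ((Y x ∧ GM x) ∨ Tsel β x) → T ((Y ∪ˢ pairs β) x ∧ GM x)
    g p with T-∨⁻ {Y x ∧ GM x} {Tsel β x} p
    ... | inj₁ h = T-∧⁺ {(Y ∪ˢ pairs β) x} {GM x} (T-∨⁺ˡ {Y x} {pairs β x} (T-∧⁻ˡ {Y x} {GM x} h)) (T-∧⁻ʳ {Y x} {GM x} h)
    ... | inj₂ h = T-∧⁺ {(Y ∪ˢ pairs β) x} {GM x}
                     (T-∨⁺ʳ {Y x} {pairs β x} (pairs⁺ β x (T-∧⁻ˡ {x ∈ᵇ Tl} {β x} h) (T-∧⁻ʳ {x ∈ᵇ Tl} {β x} h) x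
                                                       (T-∨⁺ˡ {x ≡ᵇ x} {x ≡ᵇ σ x} (T-≡ᵇ-refl x))))
                     (proj₁ (Tl⇒M×N x (T-∧⁻ˡ {x ∈ᵇ Tl} {β x} h)))

  preimageφ : Sub → Sub
  preimageφ W x = GN x ∧ W (φ x)

  pairs-∩N'-on-T : ∀ Y β → Y ⊆ E → ∀ x → T (x ∈ᵇ Tl) →
                   preimageφ ((Y ∪ˢ pairs β) ∩ˢ GN') x ≡ (offT Y ∪ˢ Tsel β) x
  pairs-∩N'-on-T Y β yg x m = T-injective f g
    where
    Z = (Y ∪ˢ pairs β) ∩ˢ GN'
    f : T (GN x ∧ Z (φ x)) → T (offT Y x ∨ Tsel β x)
    f p with T-∨⁻ {Y (σ x)} {pairs β (σ x)} (T-∧⁻ˡ {(Y ∪ˢ pairs β) (σ x)} {GN' (σ x)} (subst (λ z → T (Z z)) (φ-on-T x m) (T-∧⁻ʳ {GN x} {Z (φ x)} p)))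
    ... | inj₁ y = ⊥-elim (σ∉ yg x m y)
    ... | inj₂ q with pairs⁻ β (σ x) q
    ... | t , mt , b , inj₁ e = ⊥-elim (σM x m (subst (λ z → T (GM z)) (sym e) (proj₁ (Tl⇒M×N t mt))))
    ... | t , mt , b , inj₂ e = T-∨⁺ʳ {offT Y x} {Tsel β x} (T-∧⁺ {x ∈ᵇ Tl} {β x} m (subst (λ z → T (β z)) (sym (σinj x t m mt e)) b))
    g : T (offT Y x ∨ Tsel β x) → T (GN x ∧ Z (φ x))
    g p with T-∨⁻ {offT Y x} {Tsel β x} p
    ... | inj₁ h = ⊥-elim (T-not⁻ (T-∧⁻ˡ {not (x ∈ᵇ Tl)} {Y x} (T-∧⁻ʳ {GN x} {not (x ∈ᵇ Tl) ∧ Y x} h)) m)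
    ... | inj₂ h = T-∧⁺ {GN x} {Z (φ x)} (proj₂ (Tl⇒M×N x m))
                     (subst (λ z → T (Z z)) (sym (φ-on-T x m))
                        (T-∧⁺ {(Y ∪ˢ pairs β) (σ x)} {GN' (σ x)}
                            (T-∨⁺ʳ {Y (σ x)} {pairs β (σ x)} (pairs⁺ β x m (T-∧⁻ʳ {x ∈ᵇ Tl} {β x} h) (σ x)
                                                                 (T-∨⁺ʳ {σ x ≡ᵇ x} {σ x ≡ᵇ σ x} (T-≡ᵇ-refl (σ x)))))
                            (subst (λ z → T (GN' z)) (φ-on-T x m) (∈ᵇ-map⁺ x φ (ground N) (proj₂ (Tl⇒M×N x m))))))

  pairs-∩N'-off-T : ∀ Y β → Y ⊆ E → ∀ x → ¬ T (x ∈ᵇ Tl) →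
                    preimageφ ((Y ∪ˢ pairs β) ∩ˢ GN') x ≡ (offT Y ∪ˢ Tsel β) x
  pairs-∩N'-off-T Y β yg x nm = T-injective f g
    where
    Z = (Y ∪ˢ pairs β) ∩ˢ GN'
    f : T (GN x ∧ Z (φ x)) → T (offT Y x ∨ Tsel β x)
    f p with T-∨⁻ {Y x} {pairs β x} (T-∧⁻ˡ {(Y ∪ˢ pairs β) x} {GN' x} (subst (λ z → T (Z z)) (φ-off-T x nm) (T-∧⁻ʳ {GN x} {Z (φ x)} p)))
    ... | inj₁ y = T-∨⁺ˡ {offT Y x} {Tsel β x} (T-∧⁺ {GN x} {not (x ∈ᵇ Tl) ∧ Y x} (T-∧⁻ˡ {GN x} {Z (φ x)} p) (T-∧⁺ {not (x ∈ᵇ Tl)} {Y x} (T-not⁺ nm) y))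
    ... | inj₂ q with pairs⁻ β x q
    ... | t , mt , b , inj₁ refl = ⊥-elim (nm mt)
    ... | t , mt , b , inj₂ refl = ⊥-elim (σN t mt (T-∧⁻ˡ {GN x} {Z (φ x)} p))
    g : T (offT Y x ∨ Tsel β x) → T (GN x ∧ Z (φ x))
    g p with T-∨⁻ {offT Y x} {Tsel β x} p
    ... | inj₂ h = ⊥-elim (nm (T-∧⁻ˡ {x ∈ᵇ Tl} {β x} h))
    ... | inj₁ h = T-∧⁺ {GN x} {Z (φ x)} gx
                     (subst (λ z → T (Z z)) (sym (φ-off-T x nm))
                        (T-∧⁺ {(Y ∪ˢ pairs β) x} {GN' x} (T-∨⁺ˡ {Y x} {pairs β x} (T-∧⁻ʳ {not (x ∈ᵇ Tl)} {Y x} (T-∧⁻ʳ {GN x} {not (x ∈ᵇ Tl) ∧ Y x} h)))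
                            (subst (λ z → T (GN' z)) (φ-off-T x nm) (∈ᵇ-map⁺ x φ (ground N) gx))))
      where gx = T-∧⁻ˡ {GN x} {not (x ∈ᵇ Tl) ∧ Y x} h

  pairs-∩N' : ∀ Y β → Y ⊆ E → preimageφ ((Y ∪ˢ pairs β) ∩ˢ GN') ≐ (offT Y ∪ˢ Tsel β)
  pairs-∩N' Y β yg x = [ pairs-∩N'-on-T Y β yg x , pairs-∩N'-off-T Y β yg x ]′ (T-dec (x ∈ᵇ Tl))

  rM = rank M
  rN = rank N
  module MMt = Rank M mM
  module MNt = Rank N mN

  Tsel⊆M : ∀ β → Tsel β ⊆ GM
  Tsel⊆M β x p = proj₁ (Tl⇒M×N x (T-∧⁻ˡ {x ∈ᵇ Tl} {β x} p))
  Tsel⊆N : ∀ β → Tsel β ⊆ GN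
  Tsel⊆N β x p = proj₂ (Tl⇒M×N x (T-∧⁻ˡ {x ∈ᵇ Tl} {β x} p))
  offT⊆N : ∀ Y → offT Y ⊆ GN
  offT⊆N Y x p = T-∧⁻ˡ {GN x} p

  rankD-pairs-split : ∀ Y β → Y ⊆ E → rD (Y ∪ˢ pairs β) ≡ rM ((Y ∩ˢ GM) ∪ˢ Tsel β) + rN (offT Y ∪ˢ Tsel β)
  rankD-pairs-split Y β yg = cong₂ _+_ (IsMatroid.r-ext mM _ _ (X∩Y⊆Y (Y ∪ˢ pairs β) GM) (pairs-∩M Y β yg))
                          (IsMatroid.r-ext mN _ _ (λ x p → T-∧⁻ˡ {GN x} p) (pairs-∩N' Y β yg))

  -- The term of the closed form of μD at the selection β, once the selected pairs {t, σ t}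
  -- are split between M and the relabelled N.
  value : Sub → (ℕ → Bool) → ℕ
  value Y β = rM ((Y ∩ˢ GM) ∪ˢ Tsel β) + rN (offT Y ∪ˢ Tsel β) + IM.nunsel Tl β

  μD = IM.μ rD Tl

  μD≤value : ∀ Y → Y ⊆ E → ∀ β → μD Y ≤ value Y β
  μD≤value Y yg β = ≤-trans (IMD.μ≤ rD Tl β (IsMatroid.r-ext mD) clPairs-in-D Y (⊆-trans Y E GD yg E⊆GD))
                             (≤-reflexive (cong (_+ IM.nunsel Tl β) (trans (rankD-⋃sel≡rankD-pairs Y β (⊆-trans Y E GD yg E⊆GD)) (rankD-pairs-split Y β yg))))

  μD-attained : ∀ Y → Y ⊆ E → Σ (ℕ → Bool) λ β → μD Y ≡ value Y β
  μD-attained Y yg with IMD.μ-attained rD Tl Tl-distinct (IsMatroid.r-ext mD) clPairs-in-D Y (⊆-trans Y E GD yg E⊆GD)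
  ... | β , e = β , trans e (cong (_+ IM.nunsel Tl β) (trans (rankD-⋃sel≡rankD-pairs Y β (⊆-trans Y E GD yg E⊆GD)) (rankD-pairs-split Y β yg)))

  k = length Tl

  length-filter-split : ∀ (β : ℕ → Bool) ts → length (filterᵇ β ts) + length (filterᵇ (λ t → not (β t)) ts) ≡ length ts
  length-filter-split β [] = refl
  length-filter-split β (t ∷ ts) with β t
  ... | true = cong suc (length-filter-split β ts)
  ... | false = trans (+-suc _ _) (cong suc (length-filter-split β ts))

  nsel : (ℕ → Bool) → ℕ
  nsel β = card (ground M) (Tsel β)

  nsel≡length : ∀ β → nsel β ≡ length (filterᵇ β Tl)
  nsel≡length β = trans (card-≡ (ground M) Tl (Tsel β) β (λ x _ p → T-∧⁻ˡ {x ∈ᵇ Tl} {β x} p , T-∧⁻ʳ {x ∈ᵇ Tl} {β x} p)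
                              (λ x m p → proj₁ (Tl⇒M×N x m) , T-∧⁺ {x ∈ᵇ Tl} {β x} m p))
                   (Distinct-≐⇒length≡ (dedup (filterᵇ β Tl)) (filterᵇ β Tl) (Distinct-dedup (filterᵇ β Tl)) (Distinct-filterᵇ β Tl Tl-distinct)
                           (λ x m → ∈ᵇ-dedup⁻ x (filterᵇ β Tl) m) (λ x m → ∈ᵇ-dedup⁺ x (filterᵇ β Tl) m))

  nsel+nunsel : ∀ β → nsel β + IM.nunsel Tl β ≡ k
  nsel+nunsel β = trans (cong (_+ IM.nunsel Tl β) (nsel≡length β)) (length-filter-split β Tl)

  nsel-N : ∀ β → card (ground N) (Tsel β) ≡ nsel β
  nsel-N β = card-≡ (ground N) (ground M) (Tsel β) (Tsel β) (λ x _ p → Tsel⊆M β x p , p) (λ x _ p → Tsel⊆N β x p , p)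

  Tset-indep-M : ∀ Z → Z ⊆ Tset M N → rM Z ≡ card (ground M) Z
  Tset-indep-M Z zt = proj₂ (MMt.Indep-⊆ iM zt)

  Tset-indep-N : ∀ Z → Z ⊆ Tset M N → rN Z ≡ card (ground N) Z
  Tset-indep-N Z zt = proj₂ (MNt.Indep-⊆ iN zt)

  Tsel⊆Tset : ∀ β → Tsel β ⊆ Tset M N
  Tsel⊆Tset β x p = Tl⇒Tset x (T-∧⁻ˡ {x ∈ᵇ Tl} {β x} p)

  rM-Tsel : ∀ β → rM (Tsel β) ≡ nsel β
  rM-Tsel β = Tset-indep-M (Tsel β) (Tsel⊆Tset β)

  rN-Tsel : ∀ β → rN (Tsel β) ≡ nsel β
  rN-Tsel β = trans (Tset-indep-N (Tsel β) (Tsel⊆Tset β)) (nsel-N β)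

  none : ℕ → Bool
  none _ = false

  nunsel-none : ∀ ts → IM.nunsel ts none ≡ length ts
  nunsel-none [] = refl
  nunsel-none (t ∷ ts) = cong suc (nunsel-none ts)

  rM-empty : ∀ Z → (∀ x → ¬ T (Z x)) → rM Z ≡ 0
  rM-empty Z n = MMt.rank-empty {Z} (λ x p → ⊥-elim (n x p)) n
  rN-empty : ∀ Z → (∀ x → ¬ T (Z x)) → rN Z ≡ 0
  rN-empty Z n = MNt.rank-empty {Z} (λ x p → ⊥-elim (n x p)) n

  Tsel-none : ∀ x → ¬ T (Tsel none x)
  Tsel-none x p = T-∧⁻ʳ {x ∈ᵇ Tl} {false} p

  rN-ext : ∀ X Y → X ⊆ GN → (∀ x → T (X x) → T (Y x)) → (∀ x → T (Y x) → T (X x)) → rN X ≡ rN Y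
  rN-ext X Y xg f g = IsMatroid.r-ext mN X Y xg (⊆-antisym f g)
  rM-ext : ∀ X Y → X ⊆ GM → (∀ x → T (X x) → T (Y x)) → (∀ x → T (Y x) → T (X x)) → rM X ≡ rM Y
  rM-ext X Y xg f g = IsMatroid.r-ext mM X Y xg (⊆-antisym f g)

  Mside : Sub → (ℕ → Bool) → Sub
  Mside Y β = (Y ∩ˢ GM) ∪ˢ Tsel β
  Nside : Sub → (ℕ → Bool) → Sub
  Nside Y β = offT Y ∪ˢ Tsel β

  Mside⊆M : ∀ Y β → Mside Y β ⊆ GM
  Mside⊆M Y β = ∪-least (Y ∩ˢ GM) (Tsel β) GM (X∩Y⊆Y Y GM) (Tsel⊆M β)
  Nside⊆N : ∀ Y β → Nside Y β ⊆ GN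
  Nside⊆N Y β = ∪-least (offT Y) (Tsel β) GN (offT⊆N Y) (Tsel⊆N β)

  μD-squeeze : ∀ Y → Y ⊆ E → ∀ n β₀ → value Y β₀ ≤ n → (∀ β → n ≤ value Y β) → μD Y ≡ n
  μD-squeeze Y ye n β₀ up lo =
    ≤-antisym (≤-trans (μD≤value Y ye β₀) up) (≤-trans (lo (proj₁ attained)) (≤-reflexive (sym (proj₂ attained))))
    where attained = μD-attained Y ye

  M⊆E : GM ⊆ E
  M⊆E x p = ∈ᵇ-++⁺ˡ x (ground M) (ground N) p

  N⊆E : GN ⊆ E
  N⊆E x p = ∈ᵇ-++⁺ʳ x (ground M) (ground N) p

  offT-∅ : ∀ x → ¬ T (offT ∅ˢ x)
  offT-∅ x h = T-∧⁻ʳ {not (x ∈ᵇ Tl)} {false} (T-∧⁻ʳ {GN x} {not (x ∈ᵇ Tl) ∧ false} h)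

  value-∅ : value ∅ˢ none ≡ k
  value-∅ = cong₂ _+_ (cong₂ _+_ (rM-empty (Mside ∅ˢ none) (λ x p → Tsel-none x p)) (rN-empty (Nside ∅ˢ none) empty))
                      (nunsel-none Tl)
    where
    empty : ∀ x → ¬ T (Nside ∅ˢ none x)
    empty x p = [ offT-∅ x , Tsel-none x ]′ (T-∨⁻ {offT ∅ˢ x} {Tsel none x} p)

  k≤value-∅ : ∀ β → k ≤ value ∅ˢ β
  k≤value-∅ β = ≤-trans (≤-reflexive (sym (nsel+nunsel β)))
           (≤-trans (+-monoˡ-≤ (IM.nunsel Tl β) (m≤n+m (nsel β) (rM (Tsel β))))
             (≤-reflexive (cong (λ z → rM (Tsel β) + z + IM.nunsel Tl β) (trans (sym (rN-Tsel β)) eB))))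
    where
    eB : rN (Tsel β) ≡ rN (Nside ∅ˢ β)
    eB = rN-ext (Tsel β) (Nside ∅ˢ β) (Tsel⊆N β) (λ x p → T-∨⁺ʳ {offT ∅ˢ x} {Tsel β x} p)
                    (λ x p → [ (λ h → ⊥-elim (offT-∅ x h)) , (λ h → h) ]′ (T-∨⁻ {offT ∅ˢ x} {Tsel β x} p))

  μD-∅ : μD ∅ˢ ≡ k
  μD-∅ = μD-squeeze ∅ˢ (λ x ()) k none (≤-reflexive value-∅) k≤value-∅

  value-M : ∀ Y → Y ⊆ GM → value Y none ≡ rM Y + k
  value-M Y yg = begin
    value Y none   ≡⟨ cong₂ _+_ (cong₂ _+_ eA (rN-empty (Nside Y none) (λ x p → [ offT-empty x , Tsel-none x ]′ (T-∨⁻ {offT Y x} {Tsel none x} p))))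
                                (nunsel-none Tl) ⟩
    rM Y + 0 + k   ≡⟨ cong (_+ k) (+-identityʳ (rM Y)) ⟩
    rM Y + k       ∎
    where
    open ≡-Reasoning
    eA : rM (Mside Y none) ≡ rM Y
    eA = rM-ext (Mside Y none) Y (Mside⊆M Y none)
           (λ x p → [ (λ h → T-∧⁻ˡ {Y x} {GM x} h) , (λ h → ⊥-elim (Tsel-none x h)) ]′ (T-∨⁻ {Y x ∧ GM x} {Tsel none x} p))
           (λ x p → T-∨⁺ˡ {Y x ∧ GM x} {Tsel none x} (T-∧⁺ {Y x} {GM x} p (yg x p)))
    offT-empty : ∀ x → ¬ T (offT Y x)
    offT-empty x p = T-not⁻ (T-∧⁻ˡ {not (x ∈ᵇ Tl)} {Y x} (T-∧⁻ʳ {GN x} {not (x ∈ᵇ Tl) ∧ Y x} p))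
      (M×N⇒Tl x (yg x (T-∧⁻ʳ {not (x ∈ᵇ Tl)} {Y x} (T-∧⁻ʳ {GN x} {not (x ∈ᵇ Tl) ∧ Y x} p))) (T-∧⁻ˡ {GN x} {not (x ∈ᵇ Tl) ∧ Y x} p))

  rM+k≤value : ∀ Y → Y ⊆ GM → ∀ β → rM Y + k ≤ value Y β
  rM+k≤value Y yg β = begin
    rM Y + k                          ≡⟨ cong (rM Y +_) (sym (nsel+nunsel β)) ⟩
    rM Y + (nsel β + IM.nunsel Tl β)  ≡⟨ sym (+-assoc (rM Y) (nsel β) _) ⟩
    rM Y + nsel β + IM.nunsel Tl β    ≤⟨ +-monoˡ-≤ (IM.nunsel Tl β) (+-mono-≤
          (MMt.rank-mono (λ x p → T-∨⁺ˡ {Y x ∧ GM x} {Tsel β x} (T-∧⁺ {Y x} {GM x} p (yg x p))) (Mside⊆M Y β))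
          (≤-trans (≤-reflexive (sym (rN-Tsel β))) (MNt.rank-mono (Y⊆X∪Y (offT Y) (Tsel β)) (Nside⊆N Y β)))) ⟩
    value Y β                         ∎
    where open ≤-Reasoning

  μD-M : ∀ Y → Y ⊆ GM → μD Y ≡ rM Y + k
  μD-M Y yg = μD-squeeze Y (⊆-trans Y GM E yg M⊆E) (rM Y + k) none (≤-reflexive (value-M Y yg)) (rM+k≤value Y yg)

  value-N : ∀ Y → Y ⊆ GN → value Y Y ≡ rN Y + k
  value-N Y yg = begin
    value Y Y                         ≡⟨ cong₂ _+_ (cong₂ _+_ eA eB) refl ⟩
    nsel Y + rN Y + IM.nunsel Tl Y    ≡⟨ cong (_+ IM.nunsel Tl Y) (+-comm (nsel Y) (rN Y)) ⟩
    rN Y + nsel Y + IM.nunsel Tl Y    ≡⟨ +-assoc (rN Y) (nsel Y) _ ⟩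
    rN Y + (nsel Y + IM.nunsel Tl Y)  ≡⟨ cong (rN Y +_) (nsel+nunsel Y) ⟩
    rN Y + k                          ∎
    where
    open ≡-Reasoning
    eA : rM (Mside Y Y) ≡ nsel Y
    eA = trans (rM-ext (Mside Y Y) (Tsel Y) (Mside⊆M Y Y)
                 (λ x p → [ (λ h → T-∧⁺ {x ∈ᵇ Tl} {Y x} (M×N⇒Tl x (T-∧⁻ʳ {Y x} {GM x} h) (yg x (T-∧⁻ˡ {Y x} {GM x} h))) (T-∧⁻ˡ {Y x} {GM x} h))
                          , (λ h → h) ]′ (T-∨⁻ {Y x ∧ GM x} {Tsel Y x} p))
                 (λ x p → T-∨⁺ʳ {Y x ∧ GM x} {Tsel Y x} p))
               (rM-Tsel Y)
    eB : rN (Nside Y Y) ≡ rN Y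
    eB = rN-ext (Nside Y Y) Y (Nside⊆N Y Y)
           (λ x p → [ (λ h → T-∧⁻ʳ {not (x ∈ᵇ Tl)} {Y x} (T-∧⁻ʳ {GN x} {not (x ∈ᵇ Tl) ∧ Y x} h))
                    , (λ h → T-∧⁻ʳ {x ∈ᵇ Tl} {Y x} h) ]′ (T-∨⁻ {offT Y x} {Tsel Y x} p))
           (λ x p → case T-dec (x ∈ᵇ Tl) of λ
              { (inj₁ m) → T-∨⁺ʳ {offT Y x} {Tsel Y x} (T-∧⁺ {x ∈ᵇ Tl} {Y x} m p)
              ; (inj₂ m) → T-∨⁺ˡ {offT Y x} {Tsel Y x} (T-∧⁺ {GN x} {not (x ∈ᵇ Tl) ∧ Y x} (yg x p) (T-∧⁺ {not (x ∈ᵇ Tl)} {Y x} (T-not⁺ m) p)) })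

  module _ (Y : Sub) (yg : Y ⊆ GN) (β : ℕ → Bool) where
    private
      A = Mside Y β
      B = Nside Y β
      W = A ∖ˢ Tsel β

    unselected⊆Tset : W ⊆ Tset M N
    unselected⊆Tset x p = case T-∨⁻ {Y x ∧ GM x} {Tsel β x} (T-∧⁻ˡ {A x} {not (Tsel β x)} p) of λ
      { (inj₁ h) → T-∧⁺ {GM x} {GN x} (T-∧⁻ʳ {Y x} {GM x} h) (yg x (T-∧⁻ˡ {Y x} {GM x} h))
      ; (inj₂ h) → ⊥-elim (T-not⁻ (T-∧⁻ʳ {A x} {not (Tsel β x)} p) h) }

    Mside⊆Tset : A ⊆ Tset M N
    Mside⊆Tset x p = case T-∨⁻ {Y x ∧ GM x} {Tsel β x} p of λ
      { (inj₁ h) → T-∧⁺ {GM x} {GN x} (T-∧⁻ʳ {Y x} {GM x} h) (yg x (T-∧⁻ˡ {Y x} {GM x} h))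
      ; (inj₂ h) → Tsel⊆Tset β x h }

    rM-Mside : rM A ≡ nsel β + card (ground M) W
    rM-Mside = begin
      rM A                                                             ≡⟨ Tset-indep-M A Mside⊆Tset ⟩
      card (ground M) A                                                ≡⟨ sym eU ⟩
      card (ground M) (Tsel β ∪ˢ W)                                    ≡⟨ sym (+-identityʳ _) ⟩
      card (ground M) (Tsel β ∪ˢ W) + 0                                ≡⟨ cong (card (ground M) (Tsel β ∪ˢ W) +_) (sym eI) ⟩
      card (ground M) (Tsel β ∪ˢ W) + card (ground M) (Tsel β ∩ˢ W)    ≡⟨ card-modular (ground M) (Tsel β) W ⟩
      nsel β + card (ground M) W                                       ∎
      where
      open ≡-Reasoning
      eU : card (ground M) (Tsel β ∪ˢ W) ≡ card (ground M) A
      eU = card-cong (ground M) (Tsel β ∪ˢ W) A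
             (λ x _ p → [ (λ h → T-∨⁺ʳ {Y x ∧ GM x} {Tsel β x} h) , (λ h → T-∧⁻ˡ {A x} {not (Tsel β x)} h) ]′ (T-∨⁻ {Tsel β x} {W x} p))
             (λ x _ p → case T-dec (Tsel β x) of λ
                { (inj₁ h) → T-∨⁺ˡ {Tsel β x} {W x} h
                ; (inj₂ h) → T-∨⁺ʳ {Tsel β x} {W x} (T-∧⁺ {A x} {not (Tsel β x)} p (T-not⁺ h)) })
      eI : card (ground M) (Tsel β ∩ˢ W) ≡ 0
      eI = trans (card-cong (ground M) (Tsel β ∩ˢ W) ∅ˢ
                    (λ x _ p → T-not⁻ (T-∧⁻ʳ {A x} {not (Tsel β x)} (T-∧⁻ʳ {Tsel β x} {W x} p)) (T-∧⁻ˡ {Tsel β x} {W x} p)) (λ _ _ ()))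
                 (card-∅ (ground M))

    rN≤rN-Nside+card : rN Y ≤ rN B + card (ground M) W
    rN≤rN-Nside+card = begin
      rN Y                       ≤⟨ MNt.rank-mono {Y} {B ∪ˢ W} cover (∪-least B W GN (Nside⊆N Y β) wg) ⟩
      rN (B ∪ˢ W)                ≤⟨ MNt.rank-subadd (Nside⊆N Y β) wg ⟩
      rN B + rN W                ≤⟨ +-monoʳ-≤ (rN B) (MNt.rank≤card wg) ⟩
      rN B + card (ground N) W   ≡⟨ cong (rN B +_) (card-≡ (ground N) (ground M) W W (λ x _ p → T-∧⁻ˡ {GM x} {GN x} (unselected⊆Tset x p) , p) (λ x _ p → wg x p , p)) ⟩
      rN B + card (ground M) W   ∎
      where
      open ≤-Reasoning
      wg : W ⊆ GN
      wg x p = T-∧⁻ʳ {GM x} {GN x} (unselected⊆Tset x p)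
      cover : Y ⊆ (B ∪ˢ W)
      cover x p with T-dec (x ∈ᵇ Tl)
      ... | inj₂ m = T-∨⁺ˡ {B x} {W x} (T-∨⁺ˡ {offT Y x} {Tsel β x} (T-∧⁺ {GN x} {not (x ∈ᵇ Tl) ∧ Y x} (yg x p) (T-∧⁺ {not (x ∈ᵇ Tl)} {Y x} (T-not⁺ m) p)))
      ... | inj₁ m with T-dec (β x)
      ... | inj₁ b = T-∨⁺ˡ {B x} {W x} (T-∨⁺ʳ {offT Y x} {Tsel β x} (T-∧⁺ {x ∈ᵇ Tl} {β x} m b))
      ... | inj₂ b = T-∨⁺ʳ {B x} {W x} (T-∧⁺ {A x} {not (Tsel β x)} (T-∨⁺ˡ {Y x ∧ GM x} {Tsel β x} (T-∧⁺ {Y x} {GM x} p (proj₁ (Tl⇒M×N x m))))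
                                       (T-not⁺ (λ h → b (T-∧⁻ʳ {x ∈ᵇ Tl} {β x} h))))

    rN+k≤value : rN Y + k ≤ value Y β
    rN+k≤value = begin
      rN Y + k                                     ≡⟨ cong (rN Y +_) (sym (nsel+nunsel β)) ⟩
      rN Y + (nsel β + IM.nunsel Tl β)             ≤⟨ +-monoˡ-≤ (nsel β + IM.nunsel Tl β) rN≤rN-Nside+card ⟩
      rN B + cW + (nsel β + IM.nunsel Tl β)        ≡⟨ +-rotate (rN B) cW (nsel β) (IM.nunsel Tl β) ⟩
      nsel β + cW + rN B + IM.nunsel Tl β          ≡⟨ cong (λ z → z + rN B + IM.nunsel Tl β) (sym rM-Mside) ⟩
      value Y β                                    ∎
      where
      open ≤-Reasoning
      cW = card (ground M) W

  μD-N : ∀ Y → Y ⊆ GN → μD Y ≡ rN Y + k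
  μD-N Y yg = μD-squeeze Y (⊆-trans Y GN E yg N⊆E) (rN Y + k) Y (≤-reflexive (value-N Y yg)) (rN+k≤value Y yg)

  module FreeBound (K' : RawMatroid) (am : IsAmalgam K' M N) where
    mK' = proj₁ am
    ss' = proj₁ (proj₂ am)
    resM = proj₁ (proj₂ (proj₂ am))
    resN = proj₂ (proj₂ (proj₂ am))
    GK' = ⟦ ground K' ⟧
    module MK' = Rank K' mK'
    rK' = rank K'

    K'⊆E : GK' ⊆ E
    K'⊆E x p = subst T (ss' x) p
    E⊆K' : E ⊆ GK'
    E⊆K' x p = subst T (sym (ss' x)) p
    M⊆K' : GM ⊆ GK'
    M⊆K' x p = E⊆K' x (∈ᵇ-++⁺ˡ x (ground M) (ground N) p)
    N⊆K' : GN ⊆ GK'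
    N⊆K' x p = E⊆K' x (∈ᵇ-++⁺ʳ x (ground M) (ground N) p)

    card+k≤value : ∀ X → Indep K' X → ∀ β → card (ground K') X + k ≤ value X β
    card+k≤value X (xg , ix) β = begin
      card (ground K') X + k ≡⟨ cong₂ _+_ (sym ix) (sym (nsel+nunsel β)) ⟩
      rK' X + (nsel β + IM.nunsel Tl β) ≡⟨ sym (+-assoc (rK' X) (nsel β) _) ⟩
      rK' X + nsel β + IM.nunsel Tl β ≤⟨ +-monoˡ-≤ (IM.nunsel Tl β) (+-mono-≤ l1 l2) ⟩
      rK' (A ∪ˢ B) + rK' (A ∩ˢ B) + IM.nunsel Tl β ≤⟨ +-monoˡ-≤ (IM.nunsel Tl β) (MK'.rank-submod ag bg) ⟩
      rK' A + rK' B + IM.nunsel Tl β ≡⟨ cong (_+ IM.nunsel Tl β) (cong₂ _+_ (resM A (Mside⊆M X β)) (resN B (Nside⊆N X β))) ⟩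
      value X β ∎
      where
      open ≤-Reasoning
      A = Mside X β
      B = Nside X β
      ag = ⊆-trans A GM GK' (Mside⊆M X β) M⊆K'
      bg = ⊆-trans B GN GK' (Nside⊆N X β) N⊆K'
      abg = ∪-least A B GK' ag bg
      xe = ⊆-trans X GK' E xg K'⊆E
      cover : X ⊆ (A ∪ˢ B)
      cover x p with T-dec (GM x)
      ... | inj₁ gm = T-∨⁺ˡ {A x} {B x} (T-∨⁺ˡ {X x ∧ GM x} {Tsel β x} (T-∧⁺ {X x} {GM x} p gm))
      ... | inj₂ ngm with E⁻ x (xe x p)
      ... | inj₁ gm = ⊥-elim (ngm gm)
      ... | inj₂ gn = T-∨⁺ʳ {A x} {B x} (T-∨⁺ˡ {offT X x} {Tsel β x}
                          (T-∧⁺ {GN x} {not (x ∈ᵇ Tl) ∧ X x} gn (T-∧⁺ {not (x ∈ᵇ Tl)} {X x} (T-not⁺ (λ m → ngm (proj₁ (Tl⇒M×N x m)))) p)))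
      l1 : rK' X ≤ rK' (A ∪ˢ B)
      l1 = MK'.rank-mono cover abg
      l2 : nsel β ≤ rK' (A ∩ˢ B)
      l2 = ≤-trans (≤-reflexive (trans (sym (rM-Tsel β)) (sym (resM (Tsel β) (Tsel⊆M β)))))
             (MK'.rank-mono (∩-greatest (Tsel β) A B (Y⊆X∪Y (X ∩ˢ GM) (Tsel β)) (Y⊆X∪Y (offT X) (Tsel β)))
                     (⊆-trans (A ∩ˢ B) A GK' (X∩Y⊆X A B) ag))

    card+k≤μD : ∀ X → Indep K' X → card (ground K') X + k ≤ μD X
    card+k≤μD X ix = ≤-trans (card+k≤value X ix (proj₁ attained)) (≤-reflexive (sym (proj₂ attained)))
      where attained = μD-attained X (⊆-trans X GK' E (proj₁ ix) K'⊆E)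

  rankH-Q : rank H Q ≡ k
  rankH-Q = trans (IsMatroid.r-ext mH Q (∅ˢ ∪ˢ Q) Q⊆ (λ x → refl)) (trans (rankH≡μ ∅ˢ (λ x ())) μD-∅)

  rankK≡μD∸k : ∀ X → X ⊆ E → rank K X ≡ μD X ∸ k
  rankK≡μD∸k X xg = cong₂ _∸_ (rankH≡μ X (⊆-trans X E GD xg E⊆GD)) rankH-Q

  Q∉E : ∀ x → T (E x) → ¬ T (Q x)
  Q∉E x p q with any≡⁻ κ Tl x q
  ... | t , m , refl with E⁻ (κ t) p
  ... | inj₁ a = κM t m a
  ... | inj₂ b = κN t m b

  S∉E : ∀ x → T (E x) → ¬ T (S x)
  S∉E x p q with any≡⁻ σ Tl x q
  ... | t , m , refl = σ∉ {E} (λ y h → h) t m p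

  GK = ⟦ ground K ⟧

  K-ground : sameSet (ground K) (ground M ++ ground N)
  K-ground x = T-injective f g
    where
    gQ = filterᵇ (λ x → not (Q x)) (ground H)
    f : T (x ∈ᵇ ground K) → T (E x)
    f p with ∈ᵇ-filterᵇ⁻ (λ x → not (S x)) x gQ p | ∈ᵇ-filterᵇ⇒p (λ x → not (S x)) x gQ p
    ... | p1 | ns with ∈ᵇ-filterᵇ⁻ (λ x → not (Q x)) x (ground H) p1 | ∈ᵇ-filterᵇ⇒p (λ x → not (Q x)) x (ground H) p1
    ... | p2 | nq with fold-ground⁻ Tl D x p2
    ... | inj₂ (t , m , refl) = ⊥-elim (T-not⁻ nq (any≡⁺ κ Tl t m))
    ... | inj₁ gd with ∈ᵇ-++⁻ x (ground M) (map φ (ground N)) gd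
    ... | inj₁ a = ∈ᵇ-++⁺ˡ x (ground M) (ground N) a
    ... | inj₂ b with ∈N'⁻ x b
    ... | inj₁ (t , m , refl) = ⊥-elim (T-not⁻ ns (any≡⁺ σ Tl t m))
    ... | inj₂ (c , _) = ∈ᵇ-++⁺ʳ x (ground M) (ground N) c
    g : T (E x) → T (x ∈ᵇ ground K)
    g p = ∈ᵇ-filterᵇ⁺ (λ x → not (S x)) x gQ
            (∈ᵇ-filterᵇ⁺ (λ x → not (Q x)) x (ground H) (fold-ground⁺ Tl D x (E⊆GD x p)) (T-not⁺ (Q∉E x p)))
            (T-not⁺ (S∉E x p))

  E⊆K : E ⊆ GK
  E⊆K x p = subst T (sym (K-ground x)) p

  K↾M : ∀ X → X ⊆ GM → rank K X ≡ rM X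
  K↾M X xg = trans (rankK≡μD∸k X xe) (trans (cong (_∸ k) (μD-M X xg)) (m+n∸n≡m (rM X) k))
    where xe : X ⊆ E
          xe x p = ∈ᵇ-++⁺ˡ x (ground M) (ground N) (xg x p)

  K↾N : ∀ X → X ⊆ GN → rank K X ≡ rN X
  K↾N X xg = trans (rankK≡μD∸k X xe) (trans (cong (_∸ k) (μD-N X xg)) (m+n∸n≡m (rN X) k))
    where xe : X ⊆ E
          xe x p = ∈ᵇ-++⁺ʳ x (ground M) (ground N) (xg x p)

  isAmalgam : IsAmalgam K M N
  isAmalgam = mK , K-ground , K↾M , K↾N

  freeness : ∀ K' → IsAmalgam K' M N → ∀ X → Indep K' X → Indep K X
  freeness K' am X (xg , ix) = xgK , ≤-antisym (IsMatroid.r-bound mK X xgK) ge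
    where
    open FreeBound K' am
    xe = ⊆-trans X GK' E xg K'⊆E
    xgK = ⊆-trans X E GK xe E⊆K
    cc : card (ground K) X ≡ card (ground K') X
    cc = card-≡ (ground K) (ground K') X X (λ x _ p → xg x p , p) (λ x _ p → xgK x p , p)
    ge : card (ground K) X ≤ rank K X
    ge = begin
      card (ground K) X ≡⟨ cc ⟩
      card (ground K') X ≡⟨ sym (m+n∸n≡m _ k) ⟩
      card (ground K') X + k ∸ k ≤⟨ ∸-monoˡ-≤ k (card+k≤μD X (xg , ix)) ⟩
      μD X ∸ k ≡⟨ sym (rankK≡μD∸k X xe) ⟩
      rank K X ∎
      where open ≤-Reasoning

  isFreeAmalgam : IsFreeAmalgam K M N
  isFreeAmalgam = isAmalgam , freeness

corollary4p11 : (M N : RawMatroid) → IsMatroid M → IsMatroid N →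
    (∃ λ x → T (Tset M N x)) →
    Indep M (Tset M N) → Indep N (Tset M N) →
    (σ κ : ℕ → ℕ) → FreshLabels M N σ κ →
    IsFreeAmalgam (bonding M N σ κ) M N
corollary4p11 M N mM mN _ iM iN σ κ fr = Bonding.isFreeAmalgam M N mM mN iM iN σ κ fr
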